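{- Let $\mathcal M$ be a transversal matroid of rank $r$ on $[n]$ with a presentation with exactly $r$ members, let $B$ be a base of $\mathcal M$ and $a=(a_1,\dots,a_m)$ its type sequence. Then $$ep_{\mathcal M}(B)=\sum_{i:\,I_i\in EP_{\mathcal M}(\phi(B))}(l_{I_i}-a_i)+ep_{\mathcal M}^{\phi(B)}(B).$$
   Context: $\mathcal M$ has presentation $(A_1,\dots,A_r)$: its bases are the transversals $\{x_1,\dots,x_r\}$, $x_j\in A_j$ distinct. The type of $x\in[n]$ is $\phi(x)=\{j\in[r]:x\in A_j\}$; for $I\subseteq[r]$, $C_I$ is the set of elements of type $I$ and $l_I=|C_I|$. Order subsets of $[r]$ by $I\prec I'$ if $|I|<|I'|$, or $|I|=|I'|$ and $I$ is lexicographically smaller; the ground set is labelled so that $\phi(x)\prec\phi(y)$ implies $x<y$. Let $I_1\prec\dots\prec I_m$ be the subsets with $l_I>0$. The type $\phi(H)$ of $H\subseteq[n]$ is the multiset of types of its elements; its type sequence is $(a_1,\dots,a_m)$ with $a_k=|H\cap C_{I_k}|$. A multiset of subsets of $[r]$ is valid if it satisfies Hall's condition and maximal if it has $r$ members. An element $e\notin B$ is externally passive for $B$ if $(B\cup e)\setminus j$ is a base for some $j>e$; $ep_{\mathcal M}(B)$ counts them. $ep_{\mathcal M}(\phi(B))$ is the minimum of $ep_{\mathcal M}(B')$ over bases $B'$ with $\phi(B')=\phi(B)$, and $ep^{\phi(B)}_{\mathcal M}(B)=ep_{\mathcal M}(B)-ep_{\mathcal M}(\phi(B))$. $EP_{\mathcal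 M}(\phi(B))$ is the set of $I\subseteq[r]$ for which there is $I'\subseteq[r]$ with $I\prec I'$ such that removing one copy of $I'$ from $\phi(B)$ and adding one copy of $I$ gives a maximal valid multiset. -}

module Defs where

open import Data.Bool using (Bool; true; false; _∧_; _∨_; not; if_then_else_)
import Data.Bool as Bool
open import Data.Nat using (ℕ; zero; suc; _+_; _∸_; _⊓_; _<ᵇ_; _≡ᵇ_)
open import Data.Fin using (Fin; zero; suc; _<?_)
import Data.Fin as Fin
open import Data.Vec using (Vec; []; _∷_; lookup; tabulate)
open import Data.List using (List; []; _∷_; length; map; concatMap; filterᵇ; foldr)
open import Data.Bool.ListAction using (any; all)
open import Data.Nat.ListAction using (sum)
open import Data.List using (allFin)
open import Relation.Nullary.Decidable using (⌊_⌋)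
open import Function using (_∘_)

anyF : ∀ {k} → (Fin k → Bool) → Bool
anyF {zero}  f = false
anyF {suc k} f = f zero ∨ anyF (f ∘ suc)

allF : ∀ {k} → (Fin k → Bool) → Bool
allF {zero}  f = true
allF {suc k} f = f zero ∧ allF (f ∘ suc)

countF : ∀ {k} → (Fin k → Bool) → ℕ
countF {zero}  f = 0
countF {suc k} f = (if f zero then 1 else 0) + countF (f ∘ suc)

eqFin : ∀ {k} → Fin k → Fin k → Bool
eqFin x y = ⌊ x Fin.≟ y ⌋

ltFin : ∀ {k} → Fin k → Fin k → Bool
ltFin x y = ⌊ x <? y ⌋

eqBool : Bool → Bool → Bool
eqBool x y = ⌊ x Bool.≟ y ⌋

-- A subset of [k] is a characteristic vector (as Data.Fin.Subset).
Sub : ℕ → Set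
Sub k = Vec Bool k

eqSub : ∀ {k} → Sub k → Sub k → Bool
eqSub u v = allF (λ i → eqBool (lookup u i) (lookup v i))

card : ∀ {k} → Sub k → ℕ
card u = countF (lookup u)

allSubs : (k : ℕ) → List (Sub k)
allSubs zero    = [] ∷ []
allSubs (suc k) = concatMap (λ b → map (b ∷_) (allSubs k)) (true ∷ false ∷ [])

allMaps : (n k : ℕ) → List (Vec (Fin n) k)
allMaps n zero    = [] ∷ []
allMaps n (suc k) = concatMap (λ x → map (x ∷_) (allMaps n k)) (allFin n)

Presentation : ℕ → ℕ → Set
Presentation n r = Vec (Sub n) r

module _ {n r : ℕ} (A : Presentation n r) where

  -- B is a base iff B = {x_1,…,x_r} with x_j ∈ A_j pairwise distinct
  isBase : Sub n → Bool
  isBase B = any (λ f →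
      allF (λ i → allF (λ j → eqFin i j ∨ not (eqFin (lookup f i) (lookup f j))))
    ∧ allF (λ j → lookup (lookup A j) (lookup f j))
    ∧ allF (λ x → eqBool (lookup B x) (anyF (λ j → eqFin (lookup f j) x))))
    (allMaps n r)

  φ : Fin n → Sub r
  φ x = tabulate (λ j → lookup (lookup A j) x)

  extPassive : Sub n → Fin n → Bool
  extPassive B e = not (lookup B e) ∧
    anyF (λ j → ltFin e j ∧
      isBase (tabulate (λ x → (lookup B x ∨ eqFin x e) ∧ not (eqFin x j))))

  ep : Sub n → ℕ
  ep B = countF (extPassive B)

  -- multiplicity of type I in the multiset φ(H), i.e. |H ∩ C_I|
  mult : Sub n → Sub r → ℕ
  mult H I = countF (λ x → lookup H x ∧ eqSub (φ x) I)

  l : Sub r → ℕ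
  l I = countF (λ x → eqSub (φ x) I)

  sameType : Sub n → Sub n → Bool
  sameType H H' = all (λ I → mult H I ≡ᵇ mult H' I) (allSubs r)

  -- ep_M(φ(B)) = min { ep(B') : B' base, φ(B') = φ(B) }   (B itself is such a B')
  epType : Sub n → ℕ
  epType B = foldr (λ B' m → if isBase B' ∧ sameType B' B then ep B' ⊓ m else m)
                   (ep B) (allSubs n)

  epRel : Sub n → ℕ
  epRel B = ep B ∸ epType B

  typeList : Sub n → List (Sub r)
  typeList H = map φ (filterᵇ (lookup H) (allFin n))

-- lexicographic comparison of equal-size sets (sorted element sequences):
-- at the first index where they differ, the smaller set contains it
lexLt : ∀ {k} → Sub k → Sub k → Bool
lexLt []       []       = false
lexLt (x ∷ u) (y ∷ v) = if eqBool x y then lexLt u v else x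

_≺_ : ∀ {k} → Sub k → Sub k → Bool
I ≺ I' = (card I <ᵇ card I') ∨ ((card I ≡ᵇ card I') ∧ lexLt I I')

memL : ∀ {k} → Sub k → List (Sub k) → Bool
memL I L = any (eqSub I) L

removeOne : ∀ {k} → Sub k → List (Sub k) → List (Sub k)
removeOne I []       = []
removeOne I (J ∷ L) = if eqSub I J then L else J ∷ removeOne I L

emptySub : ∀ {k} → Sub k
emptySub = tabulate (λ _ → false)

unionSub : ∀ {k} → Sub k → Sub k → Sub k
unionSub u v = tabulate (λ i → lookup u i ∨ lookup v i)

selUnion : ∀ {k} (L : List (Sub k)) → Vec Bool (length L) → Sub k
selUnion []       []       = emptySub
selUnion (J ∷ L) (b ∷ s) = if b then unionSub J (selUnion L s) else selUnion L s

selCount : ∀ {k} (L : List (Sub k)) → Vec Bool (length L) → ℕ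
selCount []       []       = 0
selCount (J ∷ L) (b ∷ s) = (if b then 1 else 0) + selCount L s

-- Hall's condition: every sub-multiset has union at least its size
valid : ∀ {k} → List (Sub k) → Bool
valid L = all (λ s → (card (selUnion L s) <ᵇ selCount L s) Bool.xor true)
              (allSubs (length L))

maximal : (r : ℕ) → List (Sub r) → Bool
maximal r L = length L ≡ᵇ r

module _ {n r : ℕ} (A : Presentation n r) where

  inEP : Sub n → Sub r → Bool
  inEP B I = any (λ I' → (I ≺ I') ∧ memL I' (typeList A B) ∧
                 (let L' = I ∷ removeOne I' (typeList A B)
                  in valid L' ∧ maximal r L'))
             (allSubs r)

  -- Σ_{i : I_i ∈ EP(φ(B))} (l_{I_i} − a_i), over the types I_i with l_{I_i} > 0
  sumEP : Sub n → ℕ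
  sumEP B = sum (map (λ I → if (0 <ᵇ l A I) ∧ inEP B I
                              then l A I ∸ mult A B I else 0)
                     (allSubs r))

module Submission where

-- Let Σ_EP = Σ_{I ∈ EP(φ(B)), l_I > 0} (l_I − a_I).  Since the classes C_I
-- partition [n], Σ_EP is the number of elements outside any base B′ of type
-- φ(B) whose type lies in EP(φ(B)).  The theorem follows from two facts:
--
--   (lower bound)  every base B′ of type φ(B) has ep(B′) ≥ Σ_EP, since each
--                  x ∉ B′ of an EP type is externally passive;
--   (attained)     the canonical base X, which takes the a_I smallest
--                  elements of each class C_I, has ep(X) = Σ_EP, since its
--                  externally passive elements all have EP types.
--
-- So ep(φ(B)) = Σ_EP, and ep(B) = Σ_EP + (ep(B) − ep(φ(B))).  Both facts use
-- that S is a base iff φ(S) is a maximal valid multiset; the hard half of this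
-- is Hall's marriage theorem, proved below.

open import Defs
open import Data.Bool using (Bool; true; false; _∧_; _∨_; not; if_then_else_; T; T?; _xor_)
import Data.Bool.Properties as BoolP
open import Data.Empty using (⊥; ⊥-elim)
open import Data.Fin using (Fin; zero; suc)
import Data.Fin as Fin
import Data.Fin.Properties as FinP
open import Data.List using (List; []; _∷_; length; map; concatMap; filterᵇ; foldr; _++_; allFin)
import Data.List as List
import Data.List.Properties as ListP
open import Data.List.Membership.Propositional using (_∈_; _∉_)
open import Data.List.Membership.Propositional.Properties
  using (∈-allFin; ∈-map⁺; ∈-map⁻; ∈-++⁺ˡ; ∈-++⁺ʳ; ∈-filter⁺; ∈-filter⁻)
import Data.List.Membership.DecPropositional as DecMembership
open import Data.List.Relation.Unary.All using (All; []; _∷_)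
import Data.List.Relation.Unary.All as All
open import Data.List.Relation.Unary.Any using (here; there)
open import Data.List.Relation.Unary.Unique.Propositional using (Unique)
open import Data.List.Relation.Unary.AllPairs using ([]; _∷_)
import Data.List.Relation.Unary.Unique.Propositional.Properties as UniqueP
open import Data.Bool.ListAction using (any; all)
open import Data.Nat using (ℕ; zero; suc; _+_; _∸_; _≤_; _<_; z≤n; s≤s; _⊓_; _<ᵇ_; _≡ᵇ_)
open import Data.Nat.ListAction using (sum)
open import Data.Nat.ListAction.Properties using (sum-++)
open import Data.Nat.Properties
open import Algebra.Properties.CommutativeSemigroup +-commutativeSemigroup using (interchange)
open import Data.Product using (Σ; ∃; _×_; _,_; proj₁; proj₂)
open import Data.Sum using (_⊎_; inj₁; inj₂)
open import Data.Unit using (tt)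
open import Data.Vec using (Vec; []; _∷_; lookup; tabulate; toList)
import Data.Vec.Properties as VecP
open import Function using (_∘_; id)
open import Relation.Binary using (tri<; tri≈; tri>)
open import Relation.Binary.PropositionalEquality
open import Relation.Nullary using (yes; no)

true≢false : true ≢ false
true≢false ()

∧-trueˡ : ∀ {a b} → (a ∧ b) ≡ true → a ≡ true
∧-trueˡ {true} _ = refl

∧-trueʳ : ∀ {a b} → (a ∧ b) ≡ true → b ≡ true
∧-trueʳ {true} p = p

∧-intro : ∀ {a b} → a ≡ true → b ≡ true → (a ∧ b) ≡ true
∧-intro refl refl = refl

∧-falseʳ : ∀ {a b} → (a ∧ b) ≡ false → a ≡ true → b ≡ false
∧-falseʳ e refl = e

∨-introˡ : ∀ {a} b → a ≡ true → (a ∨ b) ≡ true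
∨-introˡ b refl = refl

∨-introʳ : ∀ a {b} → b ≡ true → (a ∨ b) ≡ true
∨-introʳ true  _ = refl
∨-introʳ false p = p

∨-elim : ∀ {a b} → (a ∨ b) ≡ true → a ≡ true ⊎ b ≡ true
∨-elim {true}  _ = inj₁ refl
∨-elim {false} p = inj₂ p

not-true⇒false : ∀ {a} → not a ≡ true → a ≡ false
not-true⇒false {false} _ = refl

false⇒not-true : ∀ {a} → a ≡ false → not a ≡ true
false⇒not-true refl = refl

T⇒≡true : ∀ {b} → T b → b ≡ true
T⇒≡true {true} _ = refl

≡true⇒T : ∀ {b} → b ≡ true → T b
≡true⇒T refl = tt

<ᵇ-true : ∀ m n → (m <ᵇ n) ≡ true → m < n
<ᵇ-true m n e = <ᵇ⇒< m n (≡true⇒T e)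

<ᵇ-intro : ∀ {m n} → m < n → (m <ᵇ n) ≡ true
<ᵇ-intro m<n = T⇒≡true (<⇒<ᵇ m<n)

<ᵇ-false : ∀ m n → (m <ᵇ n) ≡ false → n ≤ m
<ᵇ-false m n e = ≮⇒≥ (λ m<n → true≢false (trans (sym (<ᵇ-intro m<n)) e))

≡ᵇ-refl : ∀ m → (m ≡ᵇ m) ≡ true
≡ᵇ-refl m = T⇒≡true (≡⇒≡ᵇ m m refl)

eqFin-refl : ∀ {k} (i : Fin k) → eqFin i i ≡ true
eqFin-refl i with i Fin.≟ i
... | yes _ = refl
... | no ne = ⊥-elim (ne refl)

eqFin-true : ∀ {k} {i j : Fin k} → eqFin i j ≡ true → i ≡ j
eqFin-true {i = i} {j} e with i Fin.≟ j
... | yes p = p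

eqFin-false : ∀ {k} {i j : Fin k} → i ≢ j → eqFin i j ≡ false
eqFin-false {i = i} {j} ne with i Fin.≟ j
... | yes p = ⊥-elim (ne p)
... | no _ = refl

eqFin-suc : ∀ {k} (i j : Fin k) → eqFin (suc i) (suc j) ≡ eqFin i j
eqFin-suc i j with i Fin.≟ j
... | yes _ = refl
... | no _  = refl

ltFin-intro : ∀ {k} {x y : Fin k} → x Fin.< y → ltFin x y ≡ true
ltFin-intro {x = x} {y} lt with x Fin.<? y
... | yes _ = refl
... | no nlt = ⊥-elim (nlt lt)

ltFin-elim : ∀ {k} {x y : Fin k} → ltFin x y ≡ true → x Fin.< y
ltFin-elim {x = x} {y} e with x Fin.<? y
... | yes p = p

eqBool-refl : ∀ b → eqBool b b ≡ true
eqBool-refl true  = refl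
eqBool-refl false = refl

eqBool-true : ∀ {a b} → eqBool a b ≡ true → a ≡ b
eqBool-true {true}  {true}  _ = refl
eqBool-true {false} {false} _ = refl

eqSub-refl : ∀ {k} (u : Sub k) → eqSub u u ≡ true
eqSub-refl []      = refl
eqSub-refl (b ∷ u) = ∧-intro (eqBool-refl b) (eqSub-refl u)

eqSub-true : ∀ {k} {u v : Sub k} → eqSub u v ≡ true → u ≡ v
eqSub-true {u = []}    {[]}    _ = refl
eqSub-true {u = b ∷ u} {c ∷ v} p =
  cong₂ _∷_ (eqBool-true (∧-trueˡ p)) (eqSub-true (∧-trueʳ {eqBool b c} p))

eqSub-false : ∀ {k} {u v : Sub k} → eqSub u v ≡ false → u ≢ v
eqSub-false {u = u} e refl = true≢false (trans (sym (eqSub-refl u)) e)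

eqSub-sym : ∀ {k} (u v : Sub k) → eqSub u v ≡ eqSub v u
eqSub-sym u v with eqSub u v in e | eqSub v u in e′
... | true  | true  = refl
... | false | false = refl
... | true  | false = ⊥-elim (eqSub-false {u = v} e′ (sym (eqSub-true {u = u} e)))
... | false | true  = ⊥-elim (eqSub-false {u = u} e (sym (eqSub-true {u = v} e′)))

ind : Bool → ℕ
ind b = if b then 1 else 0

countF-cong : ∀ {k} {f g : Fin k → Bool} → (∀ i → f i ≡ g i) → countF f ≡ countF g
countF-cong {zero}          h = refl
countF-cong {suc k} {f} {g} h = cong₂ (λ b c → ind b + c) (h zero) (countF-cong (h ∘ suc))

countF-false : ∀ {k} → countF {k} (λ _ → false) ≡ 0
countF-false {zero}  = refl
countF-false {suc k} = countF-false {k}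

countF-true : ∀ {k} → countF {k} (λ _ → true) ≡ k
countF-true {zero}  = refl
countF-true {suc k} = cong suc (countF-true {k})

countF-≤-+ : ∀ {k} {f g h : Fin k → Bool} → (∀ i → ind (f i) ≤ ind (g i) + ind (h i)) →
             countF f ≤ countF g + countF h
countF-≤-+ {zero}  p = z≤n
countF-≤-+ {suc k} {f} {g} {h} p = begin
  ind (f zero) + countF (f ∘ suc)
    ≤⟨ +-mono-≤ (p zero) (countF-≤-+ {k} {f ∘ suc} {g ∘ suc} {h ∘ suc} (p ∘ suc)) ⟩
  (ind (g zero) + ind (h zero)) + (countF (g ∘ suc) + countF (h ∘ suc))
    ≡⟨ interchange (ind (g zero)) (ind (h zero)) _ _ ⟩
  (ind (g zero) + countF (g ∘ suc)) + (ind (h zero) + countF (h ∘ suc)) ∎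
  where open ≤-Reasoning

countF-+-≡ : ∀ {k} {f g h e : Fin k → Bool} →
             (∀ i → ind (f i) + ind (g i) ≡ ind (h i) + ind (e i)) →
             countF f + countF g ≡ countF h + countF e
countF-+-≡ {zero}  p = refl
countF-+-≡ {suc k} {f} {g} {h} {e} p = begin
  (ind (f zero) + countF (f ∘ suc)) + (ind (g zero) + countF (g ∘ suc))
    ≡⟨ interchange (ind (f zero)) (countF (f ∘ suc)) _ _ ⟩
  (ind (f zero) + ind (g zero)) + (countF (f ∘ suc) + countF (g ∘ suc))
    ≡⟨ cong₂ _+_ (p zero) (countF-+-≡ {k} {f ∘ suc} {g ∘ suc} {h ∘ suc} {e ∘ suc} (p ∘ suc)) ⟩
  (ind (h zero) + ind (e zero)) + (countF (h ∘ suc) + countF (e ∘ suc))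
    ≡⟨ interchange (ind (h zero)) (ind (e zero)) _ _ ⟩
  (ind (h zero) + countF (h ∘ suc)) + (ind (e zero) + countF (e ∘ suc)) ∎
  where open ≡-Reasoning

countF-mono : ∀ {k} {f g : Fin k → Bool} → (∀ i → f i ≡ true → g i ≡ true) → countF f ≤ countF g
countF-mono {k} {f} {g} p =
  subst (countF f ≤_) (trans (cong (countF g +_) (countF-false {k})) (+-identityʳ (countF g)))
    (countF-≤-+ {k} {f} {g} {λ _ → false} pointwise)
  where
  pointwise : ∀ i → ind (f i) ≤ ind (g i) + 0
  pointwise i with f i in fi
  ... | false = z≤n
  ... | true rewrite p i fi = s≤s z≤n

countF-pos : ∀ {k} (f : Fin k → Bool) → 0 < countF f → ∃ λ i → f i ≡ true
countF-pos {suc k} f p with f zero in e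
... | true = zero , e
... | false with countF-pos (f ∘ suc) p
...   | i , q = suc i , q

countF-single : ∀ {k} (x : Fin k) (g : Fin k → Bool) → countF (λ i → eqFin i x ∧ g i) ≡ ind (g x)
countF-single {suc k} zero g = begin
  ind (eqFin {suc k} zero zero ∧ g zero) + countF (λ i → eqFin (suc i) zero ∧ g (suc i))
    ≡⟨ cong₂ (λ a b → ind (a ∧ g zero) + b) (eqFin-refl {suc k} zero)
         (trans (countF-cong (λ i → cong (_∧ g (suc i)) (eqFin-false {i = suc i} {zero} (λ ()))))
                (countF-false {k})) ⟩
  ind (g zero) + 0 ≡⟨ +-identityʳ _ ⟩
  ind (g zero) ∎
  where open ≡-Reasoning
countF-single {suc k} (suc x) g = begin
  ind (eqFin zero (suc x) ∧ g zero) + countF (λ i → eqFin (suc i) (suc x) ∧ g (suc i))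
    ≡⟨ cong₂ (λ a b → ind (a ∧ g zero) + b) (eqFin-false {i = zero} {suc x} (λ ()))
         (countF-cong (λ i → cong (_∧ g (suc i)) (eqFin-suc i x))) ⟩
  countF (λ i → eqFin i x ∧ g (suc i)) ≡⟨ countF-single x (g ∘ suc) ⟩
  ind (g (suc x)) ∎
  where open ≡-Reasoning

countF-remove : ∀ {k} (f : Fin k → Bool) (x : Fin k) → f x ≡ true →
                countF f ≡ suc (countF (λ i → f i ∧ not (eqFin i x)))
countF-remove {k} f x fx = begin
  countF f                                        ≡⟨ sym (+-identityʳ _) ⟩
  countF f + 0                                    ≡⟨ cong (countF f +_) (sym (countF-false {k})) ⟩
  countF f + countF {k} (λ _ → false)             ≡⟨ countF-+-≡ {k} {f} {λ _ → false} pointwise ⟩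
  countF (λ i → eqFin i x ∧ f i) + countF rest    ≡⟨ cong (_+ countF rest) (countF-single x f) ⟩
  ind (f x) + countF rest                         ≡⟨ cong (λ b → ind b + countF rest) fx ⟩
  suc (countF rest) ∎
  where
  open ≡-Reasoning
  rest : Fin k → Bool
  rest i = f i ∧ not (eqFin i x)
  pointwise : ∀ i → ind (f i) + ind false ≡ ind (eqFin i x ∧ f i) + ind (rest i)
  pointwise i with eqFin i x | f i
  ... | true  | true  = refl
  ... | true  | false = refl
  ... | false | true  = refl
  ... | false | false = refl

unique-length≤countF : ∀ {k} (f : Fin k → Bool) (xs : List (Fin k)) → Unique xs →
                       All (λ j → f j ≡ true) xs → length xs ≤ countF f
unique-length≤countF f []       _         _          = z≤n
unique-length≤countF f (x ∷ xs) (x∉ ∷ u) (fx ∷ fs) =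
  subst (suc (length xs) ≤_) (sym (countF-remove f x fx))
    (s≤s (unique-length≤countF (λ i → f i ∧ not (eqFin i x)) xs u (avoid xs x∉ fs)))
  where
  avoid : ∀ ys → All (x ≢_) ys → All (λ j → f j ≡ true) ys →
          All (λ j → (f j ∧ not (eqFin j x)) ≡ true) ys
  avoid []       _          _          = []
  avoid (y ∷ ys) (ne ∷ nes) (fy ∷ fys) =
    cong₂ (λ a b → a ∧ not b) fy (eqFin-false (ne ∘ sym)) ∷ avoid ys nes fys

anyF-intro : ∀ {k} (f : Fin k → Bool) i → f i ≡ true → anyF f ≡ true
anyF-intro f zero    p = ∨-introˡ _ p
anyF-intro f (suc i) p = ∨-introʳ (f zero) (anyF-intro (f ∘ suc) i p)

anyF-elim : ∀ {k} (f : Fin k → Bool) → anyF f ≡ true → ∃ λ i → f i ≡ true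
anyF-elim {suc k} f p with ∨-elim {f zero} p
... | inj₁ q = zero , q
... | inj₂ q with anyF-elim (f ∘ suc) q
...   | i , r = suc i , r

allF-intro : ∀ {k} (f : Fin k → Bool) → (∀ i → f i ≡ true) → allF f ≡ true
allF-intro {zero}  f p = refl
allF-intro {suc k} f p = ∧-intro (p zero) (allF-intro (f ∘ suc) (p ∘ suc))

allF-elim : ∀ {k} (f : Fin k → Bool) → allF f ≡ true → ∀ i → f i ≡ true
allF-elim {suc k} f p zero    = ∧-trueˡ p
allF-elim {suc k} f p (suc i) = allF-elim (f ∘ suc) (∧-trueʳ {f zero} p) i

any-intro : ∀ {X : Set} (p : X → Bool) {x} xs → x ∈ xs → p x ≡ true → any p xs ≡ true
any-intro p (y ∷ ys) (here refl) q = ∨-introˡ _ q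
any-intro p (y ∷ ys) (there m)   q = ∨-introʳ (p y) (any-intro p ys m q)

any-elim : ∀ {X : Set} (p : X → Bool) xs → any p xs ≡ true → ∃ λ x → x ∈ xs × p x ≡ true
any-elim p (y ∷ ys) q with ∨-elim {p y} q
... | inj₁ r = y , here refl , r
... | inj₂ r with any-elim p ys r
...   | x , m , s = x , there m , s

all-intro : ∀ {X : Set} (p : X → Bool) xs → (∀ x → x ∈ xs → p x ≡ true) → all p xs ≡ true
all-intro p []       f = refl
all-intro p (y ∷ ys) f = ∧-intro (f y (here refl)) (all-intro p ys (λ x m → f x (there m)))

all-elim : ∀ {X : Set} (p : X → Bool) xs → all p xs ≡ true → ∀ x → x ∈ xs → p x ≡ true
all-elim p (y ∷ ys) q x (here refl) = ∧-trueˡ q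
all-elim p (y ∷ ys) q x (there m)   = all-elim p ys (∧-trueʳ {p y} q) x m

allSubs-complete : ∀ {k} (v : Sub k) → v ∈ allSubs k
allSubs-complete []                  = here refl
allSubs-complete {suc k} (true ∷ v)  = ∈-++⁺ˡ (∈-map⁺ (true ∷_) (allSubs-complete v))
allSubs-complete {suc k} (false ∷ v) =
  ∈-++⁺ʳ (map (true ∷_) (allSubs k)) (∈-++⁺ˡ (∈-map⁺ (false ∷_) (allSubs-complete v)))

allMaps-complete : ∀ {n} k (v : Vec (Fin n) k) → v ∈ allMaps n k
allMaps-complete zero    []      = here refl
allMaps-complete {n} (suc k) (x ∷ v) = inBlock (allFin n) (∈-allFin x)
  where
  block : Fin n → List (Vec (Fin n) (suc k))
  block y = map (y ∷_) (allMaps n k)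
  inBlock : ∀ ys → x ∈ ys → (x ∷ v) ∈ concatMap block ys
  inBlock (y ∷ ys) (here refl) = ∈-++⁺ˡ (∈-map⁺ (x ∷_) (allMaps-complete k v))
  inBlock (y ∷ ys) (there m)   = ∈-++⁺ʳ (block y) (inBlock ys m)

∈-filterᵇ⁺ : ∀ {X : Set} (p : X → Bool) {x} xs → x ∈ xs → p x ≡ true → x ∈ filterᵇ p xs
∈-filterᵇ⁺ p xs m px = ∈-filter⁺ (T? ∘ p) m (≡true⇒T px)

∈-filterᵇ⁻ : ∀ {X : Set} (p : X → Bool) {x} xs → x ∈ filterᵇ p xs → p x ≡ true
∈-filterᵇ⁻ p xs m = T⇒≡true (proj₂ (∈-filter⁻ (T? ∘ p) {xs = xs} m))

countL : ∀ {X : Set} → (X → Bool) → List X → ℕ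
countL p []       = 0
countL p (x ∷ xs) = ind (p x) + countL p xs

countL-tabulate : ∀ {X : Set} {k} (g : Fin k → X) (h : X → Bool) →
                  countL h (List.tabulate g) ≡ countF (h ∘ g)
countL-tabulate {k = zero}  g h = refl
countL-tabulate {k = suc k} g h = cong (ind (h (g zero)) +_) (countL-tabulate (g ∘ suc) h)

countL-map : ∀ {X Y : Set} (p : Y → Bool) (g : X → Y) xs → countL p (map g xs) ≡ countL (p ∘ g) xs
countL-map p g []       = refl
countL-map p g (x ∷ xs) = cong (ind (p (g x)) +_) (countL-map p g xs)

countL-filterᵇ : ∀ {X : Set} (p q : X → Bool) xs →
                 countL p (filterᵇ q xs) ≡ countL (λ x → q x ∧ p x) xs
countL-filterᵇ p q []       = refl
countL-filterᵇ p q (x ∷ xs) with q x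
... | true  = cong (ind (p x) +_) (countL-filterᵇ p q xs)
... | false = countL-filterᵇ p q xs

countL-true : ∀ {X : Set} (xs : List X) → countL (λ _ → true) xs ≡ length xs
countL-true []       = refl
countL-true (x ∷ xs) = cong suc (countL-true xs)

sum-map-cong : ∀ {X : Set} {f g : X → ℕ} (xs : List X) → (∀ x → f x ≡ g x) →
               sum (map f xs) ≡ sum (map g xs)
sum-map-cong []       e = refl
sum-map-cong (x ∷ xs) e = cong₂ _+_ (e x) (sum-map-cong xs e)

sum-map-0 : ∀ {X : Set} (xs : List X) → sum (map (λ _ → 0) xs) ≡ 0
sum-map-0 []       = refl
sum-map-0 (x ∷ xs) = sum-map-0 xs

sum-map-+ : ∀ {X : Set} (f g : X → ℕ) (xs : List X) →
            sum (map (λ x → f x + g x) xs) ≡ sum (map f xs) + sum (map g xs)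
sum-map-+ f g []       = refl
sum-map-+ f g (x ∷ xs) = begin
  (f x + g x) + sum (map (λ x → f x + g x) xs) ≡⟨ cong ((f x + g x) +_) (sum-map-+ f g xs) ⟩
  (f x + g x) + (sum (map f xs) + sum (map g xs)) ≡⟨ interchange (f x) (g x) _ _ ⟩
  (f x + sum (map f xs)) + (g x + sum (map g xs)) ∎
  where open ≡-Reasoning

sum-allSubs-suc : ∀ {k} (f : Sub (suc k) → ℕ) →
  sum (map f (allSubs (suc k))) ≡
  sum (map (f ∘ (true ∷_)) (allSubs k)) + sum (map (f ∘ (false ∷_)) (allSubs k))
sum-allSubs-suc {k} f = begin
  sum (map f (map (true ∷_) (allSubs k) ++ (map (false ∷_) (allSubs k) ++ [])))
    ≡⟨ cong (λ ys → sum (map f (map (true ∷_) (allSubs k) ++ ys)))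
            (ListP.++-identityʳ (map (false ∷_) (allSubs k))) ⟩
  sum (map f (map (true ∷_) (allSubs k) ++ map (false ∷_) (allSubs k)))
    ≡⟨ cong sum (ListP.map-++ f (map (true ∷_) (allSubs k)) _) ⟩
  sum (map f (map (true ∷_) (allSubs k)) ++ map f (map (false ∷_) (allSubs k)))
    ≡⟨ sum-++ (map f (map (true ∷_) (allSubs k))) _ ⟩
  sum (map f (map (true ∷_) (allSubs k))) + sum (map f (map (false ∷_) (allSubs k)))
    ≡⟨ cong₂ (λ a b → sum a + sum b) (sym (ListP.map-∘ (allSubs k))) (sym (ListP.map-∘ (allSubs k))) ⟩
  sum (map (f ∘ (true ∷_)) (allSubs k)) + sum (map (f ∘ (false ∷_)) (allSubs k)) ∎
  where open ≡-Reasoning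

sum-eqSub≡1 : ∀ {k} (v : Sub k) → sum (map (λ I → ind (eqSub v I)) (allSubs k)) ≡ 1
sum-eqSub≡1 []                  = refl
sum-eqSub≡1 {suc k} (true ∷ v)  = trans (sum-allSubs-suc (λ I → ind (eqSub (true ∷ v) I)))
  (cong₂ _+_ (sum-eqSub≡1 v) (sum-map-0 (allSubs k)))
sum-eqSub≡1 {suc k} (false ∷ v) = trans (sum-allSubs-suc (λ I → ind (eqSub (false ∷ v) I)))
  (cong₂ _+_ (sum-map-0 (allSubs k)) (sum-eqSub≡1 v))

countF-by-classes : ∀ {k r} (f : Fin k → Bool) (τ : Fin k → Sub r) →
  countF f ≡ sum (map (λ I → countF (λ x → f x ∧ eqSub (τ x) I)) (allSubs r))
countF-by-classes {zero}  {r} f τ = sym (sum-map-0 (allSubs r))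
countF-by-classes {suc k} {r} f τ = begin
  ind (f zero) + countF (f ∘ suc)
    ≡⟨ cong₂ _+_ first (countF-by-classes (f ∘ suc) (τ ∘ suc)) ⟩
  sum (map (λ I → ind (f zero ∧ eqSub (τ zero) I)) (allSubs r)) +
  sum (map (λ I → countF (λ x → f (suc x) ∧ eqSub (τ (suc x)) I)) (allSubs r))
    ≡⟨ sym (sum-map-+ (λ I → ind (f zero ∧ eqSub (τ zero) I)) _ (allSubs r)) ⟩
  sum (map (λ I → countF (λ x → f x ∧ eqSub (τ x) I)) (allSubs r)) ∎
  where
  open ≡-Reasoning
  first : ind (f zero) ≡ sum (map (λ I → ind (f zero ∧ eqSub (τ zero) I)) (allSubs r))
  first with f zero
  ... | true  = sym (sum-eqSub≡1 (τ zero))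
  ... | false = sym (sum-map-0 (allSubs r))

cnt : ∀ {k} → Sub k → List (Sub k) → ℕ
cnt K L = countL (λ J → eqSub J K) L

SameCounts : ∀ {k} → List (Sub k) → List (Sub k) → Set
SameCounts L L′ = ∀ K → cnt K L ≡ cnt K L′

cnt-removeOne : ∀ {k} (I K : Sub k) L → memL I L ≡ true →
                cnt K (removeOne I L) + ind (eqSub I K) ≡ cnt K L
cnt-removeOne I K (J ∷ L) m with eqSub I J in e
... | true rewrite eqSub-true {u = I} {J} e = +-comm (cnt K L) _
... | false = trans (+-assoc (ind (eqSub J K)) (cnt K (removeOne I L)) _)
                    (cong (ind (eqSub J K) +_) (cnt-removeOne I K L m))

length-removeOne : ∀ {k} (I : Sub k) L → memL I L ≡ true → suc (length (removeOne I L)) ≡ length L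
length-removeOne I (J ∷ L) m with eqSub I J
... | true  = refl
... | false = cong suc (length-removeOne I L m)

cnt-pos⇒memL : ∀ {k} (I : Sub k) L → 0 < cnt I L → memL I L ≡ true
cnt-pos⇒memL I (J ∷ L) p with eqSub J I in e
... | true  = ∨-introˡ _ (trans (eqSub-sym I J) e)
... | false = ∨-introʳ (eqSub I J) (cnt-pos⇒memL I L p)

memL⇒cnt-pos : ∀ {k} (I : Sub k) L → memL I L ≡ true → 0 < cnt I L
memL⇒cnt-pos I L m = subst (0 <_) (cnt-removeOne I I L m)
  (subst (λ b → 0 < cnt I (removeOne I L) + ind b) (sym (eqSub-refl I)) (m≤n+m 1 _))

cnt-head-pos : ∀ {k} (J : Sub k) L → 0 < cnt J (J ∷ L)
cnt-head-pos J L = subst (λ b → 0 < ind b + cnt J L) (sym (eqSub-refl J)) (s≤s z≤n)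

sameCounts-mem : ∀ {k} (J : Sub k) L L′ → SameCounts L (J ∷ L′) → memL J L ≡ true
sameCounts-mem J L L′ ce = cnt-pos⇒memL J L (subst (0 <_) (sym (ce J)) (cnt-head-pos J L′))

sameCounts-removeOne : ∀ {k} (J : Sub k) L L′ → SameCounts L (J ∷ L′) → SameCounts (removeOne J L) L′
sameCounts-removeOne J L L′ ce K = +-cancelʳ-≡ (ind (eqSub J K)) _ _
  (trans (cnt-removeOne J K L (sameCounts-mem J L L′ ce)) (trans (ce K) (+-comm (ind (eqSub J K)) _)))

sameCounts-length : ∀ {k} (L′ L : List (Sub k)) → SameCounts L L′ → length L ≡ length L′
sameCounts-length []       []      ce = refl
sameCounts-length []       (J ∷ L) ce = ⊥-elim (<⇒≱ (cnt-head-pos J L) (≤-reflexive (ce J)))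
sameCounts-length (J ∷ L′) L       ce = trans (sym (length-removeOne J L (sameCounts-mem J L L′ ce)))
  (cong suc (sameCounts-length L′ (removeOne J L) (sameCounts-removeOne J L L′ ce)))

-- Hall's marriage theorem for finite families of subsets of Fin r.
-- Subfamilies are selected by boolean masks (lists of Bool; a missing
-- entry means "not selected").

module HallTheorem {r : ℕ} where

  Family : Set
  Family = List (Fin r → Bool)

  maskUnion : Family → List Bool → Fin r → Bool
  maskUnion []      s       i = false
  maskUnion (J ∷ L) []      i = false
  maskUnion (J ∷ L) (b ∷ s) i = (b ∧ J i) ∨ maskUnion L s i

  maskSize : Family → List Bool → ℕ
  maskSize []      s       = 0
  maskSize (J ∷ L) []      = 0
  maskSize (J ∷ L) (b ∷ s) = ind b + maskSize L s

  HallCondition : Family → Set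
  HallCondition L = ∀ s → maskSize L s ≤ countF (maskUnion L s)

  data Reps : Family → List (Fin r) → Set where
    []  : Reps [] []
    _∷_ : ∀ {J L j js} → J j ≡ true → Reps L js → Reps (J ∷ L) (j ∷ js)

  SDR : Family → Set
  SDR L = ∃ λ js → Reps L js × Unique js

  maskUnion-[] : ∀ L i → maskUnion L [] i ≡ false
  maskUnion-[] []      i = refl
  maskUnion-[] (J ∷ L) i = refl

  maskSize-[] : ∀ L → maskSize L [] ≡ 0
  maskSize-[] []      = refl
  maskSize-[] (J ∷ L) = refl

  -- Easy direction: the representatives of a selected subfamily are distinct
  -- elements of its union.

  selectReps : List Bool → List (Fin r) → List (Fin r)
  selectReps []          js       = []
  selectReps (b ∷ s)     []       = []
  selectReps (true ∷ s)  (j ∷ js) = j ∷ selectReps s js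
  selectReps (false ∷ s) (j ∷ js) = selectReps s js

  All-selectReps : ∀ {P : Fin r → Set} s js → All P js → All P (selectReps s js)
  All-selectReps []          js       a       = []
  All-selectReps (b ∷ s)     []       a       = []
  All-selectReps (true ∷ s)  (j ∷ js) (p ∷ a) = p ∷ All-selectReps s js a
  All-selectReps (false ∷ s) (j ∷ js) (p ∷ a) = All-selectReps s js a

  Unique-selectReps : ∀ s js → Unique js → Unique (selectReps s js)
  Unique-selectReps []          js       u       = []
  Unique-selectReps (b ∷ s)     []       u       = []
  Unique-selectReps (true ∷ s)  (j ∷ js) (a ∷ u) = All-selectReps s js a ∷ Unique-selectReps s js u
  Unique-selectReps (false ∷ s) (j ∷ js) (a ∷ u) = Unique-selectReps s js u

  length-selectReps : ∀ {L js} s → Reps L js → length (selectReps s js) ≡ maskSize L s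
  length-selectReps []          []       = refl
  length-selectReps []          (_ ∷ _)  = refl
  length-selectReps (b ∷ s)     []       = refl
  length-selectReps (true ∷ s)  (_ ∷ rs) = cong suc (length-selectReps s rs)
  length-selectReps (false ∷ s) (_ ∷ rs) = length-selectReps s rs

  selectReps-⊆ : ∀ {L js} s → Reps L js → All (λ j → maskUnion L s j ≡ true) (selectReps s js)
  selectReps-⊆ []          []       = []
  selectReps-⊆ []          (_ ∷ _)  = []
  selectReps-⊆ (b ∷ s)     []       = []
  selectReps-⊆ {J ∷ L} (true ∷ s) (p ∷ rs) =
    ∨-introˡ _ p ∷ All.map (λ {j} q → ∨-introʳ (J j) q) (selectReps-⊆ s rs)
  selectReps-⊆ (false ∷ s) (p ∷ rs) = selectReps-⊆ s rs

  sdr⇒hall : ∀ L → SDR L → HallCondition L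
  sdr⇒hall L (js , rs , u) s = subst (_≤ countF (maskUnion L s)) (length-selectReps s rs)
    (unique-length≤countF (maskUnion L s) (selectReps s js) (Unique-selectReps s js u) (selectReps-⊆ s rs))

  -- Hard direction, by induction on the size of the family (Halmos–Vaughan).
  -- For I ∷ L′, either every nonempty subfamily of L′ has a strict surplus
  -- (its union is larger than its size), or some nonempty subfamily is
  -- critical (union no larger than its size).

  searchMasks : ∀ m (P : List Bool → Bool) →
                (∃ λ s → P s ≡ true) ⊎ (∀ s → length s ≡ m → P s ≡ false)
  searchMasks zero P with P [] in e
  ... | true  = inj₁ ([] , e)
  ... | false = inj₂ λ { [] refl → e }
  searchMasks (suc m) P with searchMasks m (P ∘ (true ∷_))
  ... | inj₁ (s , p) = inj₁ (true ∷ s , p)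
  ... | inj₂ noTrue with searchMasks m (P ∘ (false ∷_))
  ...   | inj₁ (s , p) = inj₁ (false ∷ s , p)
  ...   | inj₂ noFalse = inj₂ λ { (true ∷ s) e → noTrue s (suc-injective e)
                                ; (false ∷ s) e → noFalse s (suc-injective e) }

  fit : Family → List Bool → List Bool
  fit []      t       = []
  fit (J ∷ L) []      = false ∷ fit L []
  fit (J ∷ L) (b ∷ t) = b ∷ fit L t

  length-fit : ∀ L t → length (fit L t) ≡ length L
  length-fit []      t       = refl
  length-fit (J ∷ L) []      = cong suc (length-fit L [])
  length-fit (J ∷ L) (b ∷ t) = cong suc (length-fit L t)

  maskUnion-fit : ∀ L t i → maskUnion L (fit L t) i ≡ maskUnion L t i
  maskUnion-fit []      t       i = refl
  maskUnion-fit (J ∷ L) []      i = trans (maskUnion-fit L [] i) (maskUnion-[] L i)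
  maskUnion-fit (J ∷ L) (b ∷ t) i = cong ((b ∧ J i) ∨_) (maskUnion-fit L t i)

  maskSize-fit : ∀ L t → maskSize L (fit L t) ≡ maskSize L t
  maskSize-fit []      t       = refl
  maskSize-fit (J ∷ L) []      = trans (maskSize-fit L []) (maskSize-[] L)
  maskSize-fit (J ∷ L) (b ∷ t) = cong (ind b +_) (maskSize-fit L t)

  minus : (Fin r → Bool) → (Fin r → Bool) → Fin r → Bool
  minus D J i = J i ∧ not (D i)

  maskUnion-minus : ∀ D L s i → maskUnion (map (minus D) L) s i ≡ (maskUnion L s i ∧ not (D i))
  maskUnion-minus D []      s       i = refl
  maskUnion-minus D (J ∷ L) []      i = refl
  maskUnion-minus D (J ∷ L) (b ∷ s) i rewrite maskUnion-minus D L s i with b | J i | D i | maskUnion L s i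
  ... | true  | true  | true  | x = BoolP.∧-zeroʳ x
  ... | true  | true  | false | x = refl
  ... | true  | false | d     | x = refl
  ... | false | j     | d     | x = refl

  maskSize-map : ∀ g L s → maskSize (map g L) s ≡ maskSize L s
  maskSize-map g []      s       = refl
  maskSize-map g (J ∷ L) []      = refl
  maskSize-map g (J ∷ L) (b ∷ s) = cong (ind b +_) (maskSize-map g L s)

  hall-minus : ∀ D L → (∀ t → maskSize L t ≤ countF (λ i → maskUnion L t i ∧ not (D i))) →
               HallCondition (map (minus D) L)
  hall-minus D L h t = subst₂ _≤_ (sym (maskSize-map (minus D) L t))
                                  (sym (countF-cong (maskUnion-minus D L t))) (h t)

  Reps-minus : ∀ D L {js} → Reps (map (minus D) L) js → Reps L js × All (λ j → D j ≡ false) js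
  Reps-minus D []      []       = [] , []
  Reps-minus D (J ∷ L) (p ∷ rs) with Reps-minus D L rs
  ... | rs′ , a = ∧-trueˡ p ∷ rs′ , not-true⇒false (∧-trueʳ {J _} p) ∷ a

  HallUpTo : ℕ → Set
  HallUpTo k = ∀ L → length L ≤ k → HallCondition L → SDR L

  -- Pick any x ∈ I,
  -- delete x from the members of L′ (Hall's condition survives because of the
  -- surplus), and add x to a system of representatives of the result.
  hall-surplus : ∀ {k} → HallUpTo k → ∀ I L′ → length L′ ≤ k → HallCondition (I ∷ L′) →
                 (∀ t → 0 < maskSize L′ t → maskSize L′ t < countF (maskUnion L′ t)) → SDR (I ∷ L′)
  hall-surplus {k} ih I L′ len H surplus =
    x ∷ js , Ix ∷ rs , All.map (λ {j} q j≡x → true≢false (trans (sym (x-in-D j≡x)) q)) avoidsX ∷ u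
    where
    xI : ∃ λ i → ((true ∧ I i) ∨ maskUnion L′ [] i) ≡ true
    xI = countF-pos _ (subst (λ z → suc z ≤ countF (λ i → (true ∧ I i) ∨ maskUnion L′ [] i))
                             (maskSize-[] L′) (H (true ∷ [])))
    x = proj₁ xI
    Ix : I x ≡ true
    Ix with ∨-elim {true ∧ I x} (proj₂ xI)
    ... | inj₁ p = p
    ... | inj₂ p = ⊥-elim (true≢false (trans (sym p) (maskUnion-[] L′ x)))
    D : Fin r → Bool
    D i = eqFin i x
    x-in-D : ∀ {j} → x ≡ j → D j ≡ true
    x-in-D refl = eqFin-refl x
    dropX : ∀ t → countF (maskUnion L′ t) ≤ suc (countF (λ i → maskUnion L′ t i ∧ not (D i)))
    dropX t = ≤-trans (countF-≤-+ {g = λ i → eqFin i x ∧ true} pointwise)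
                      (≤-reflexive (cong (_+ countF (λ i → maskUnion L′ t i ∧ not (D i))) (countF-single x (λ _ → true))))
      where
      pointwise : ∀ i → ind (maskUnion L′ t i) ≤ ind (eqFin i x ∧ true) + ind (maskUnion L′ t i ∧ not (D i))
      pointwise i with maskUnion L′ t i | eqFin i x
      ... | true  | true  = s≤s z≤n
      ... | true  | false = s≤s z≤n
      ... | false | _     = z≤n
    hallWithoutX : ∀ t → maskSize L′ t ≤ countF (λ i → maskUnion L′ t i ∧ not (D i))
    hallWithoutX t with maskSize L′ t in e
    ... | zero  = z≤n
    ... | suc c = ≤-pred (≤-trans (subst (_< countF (maskUnion L′ t)) e (surplus t (subst (0 <_) (sym e) (s≤s z≤n))))
                                  (dropX t))
    IH = ih (map (minus D) L′) (subst (_≤ k) (sym (ListP.length-map (minus D) L′)) len)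
            (hall-minus D L′ hallWithoutX)
    js = proj₁ IH
    u = proj₂ (proj₂ IH)
    rs = proj₁ (Reps-minus D L′ (proj₁ (proj₂ IH)))
    avoidsX = proj₂ (Reps-minus D L′ (proj₁ (proj₂ IH)))

  sel : Family → List Bool → Family
  sel []      s           = []
  sel (J ∷ L) []          = []
  sel (J ∷ L) (true ∷ s)  = J ∷ sel L s
  sel (J ∷ L) (false ∷ s) = sel L s

  unsel : Family → List Bool → Family
  unsel []      s           = []
  unsel (J ∷ L) []          = J ∷ L
  unsel (J ∷ L) (true ∷ s)  = unsel L s
  unsel (J ∷ L) (false ∷ s) = J ∷ unsel L s

  length-sel : ∀ L s → length (sel L s) ≡ maskSize L s
  length-sel []      s           = refl
  length-sel (J ∷ L) []          = refl
  length-sel (J ∷ L) (true ∷ s)  = cong suc (length-sel L s)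
  length-sel (J ∷ L) (false ∷ s) = length-sel L s

  length-sel+unsel : ∀ L s → length (sel L s) + length (unsel L s) ≡ length L
  length-sel+unsel []      s           = refl
  length-sel+unsel (J ∷ L) []          = refl
  length-sel+unsel (J ∷ L) (true ∷ s)  = cong suc (length-sel+unsel L s)
  length-sel+unsel (J ∷ L) (false ∷ s) = trans (+-suc (length (sel L s)) _) (cong suc (length-sel+unsel L s))

  liftMask : Family → List Bool → List Bool → List Bool
  liftMask []      s           t       = []
  liftMask (J ∷ L) []          t       = []
  liftMask (J ∷ L) (true ∷ s)  []      = []
  liftMask (J ∷ L) (true ∷ s)  (b ∷ t) = b ∷ liftMask L s t
  liftMask (J ∷ L) (false ∷ s) t       = false ∷ liftMask L s t

  maskUnion-liftMask : ∀ L s t i → maskUnion L (liftMask L s t) i ≡ maskUnion (sel L s) t i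
  maskUnion-liftMask []      s           t       i = refl
  maskUnion-liftMask (J ∷ L) []          t       i = refl
  maskUnion-liftMask (J ∷ L) (true ∷ s)  []      i = refl
  maskUnion-liftMask (J ∷ L) (true ∷ s)  (b ∷ t) i = cong ((b ∧ J i) ∨_) (maskUnion-liftMask L s t i)
  maskUnion-liftMask (J ∷ L) (false ∷ s) t       i = maskUnion-liftMask L s t i

  maskSize-liftMask : ∀ L s t → maskSize L (liftMask L s t) ≡ maskSize (sel L s) t
  maskSize-liftMask []      s           t       = refl
  maskSize-liftMask (J ∷ L) []          t       = refl
  maskSize-liftMask (J ∷ L) (true ∷ s)  []      = refl
  maskSize-liftMask (J ∷ L) (true ∷ s)  (b ∷ t) = cong (ind b +_) (maskSize-liftMask L s t)
  maskSize-liftMask (J ∷ L) (false ∷ s) t       = maskSize-liftMask L s t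

  merge : Family → List Bool → List Bool → List Bool
  merge []      s           t       = []
  merge (J ∷ L) []          t       = t
  merge (J ∷ L) (true ∷ s)  t       = true ∷ merge L s t
  merge (J ∷ L) (false ∷ s) []      = false ∷ merge L s []
  merge (J ∷ L) (false ∷ s) (b ∷ t) = b ∷ merge L s t

  maskUnion-merge : ∀ L s t i → maskUnion L (merge L s t) i ≡ (maskUnion L s i ∨ maskUnion (unsel L s) t i)
  maskUnion-merge []      s           t       i = refl
  maskUnion-merge (J ∷ L) []          t       i = refl
  maskUnion-merge (J ∷ L) (true ∷ s)  t       i rewrite maskUnion-merge L s t i = sym (BoolP.∨-assoc (J i) _ _)
  maskUnion-merge (J ∷ L) (false ∷ s) []      i rewrite maskUnion-merge L s [] i | maskUnion-[] (unsel L s) i = refl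
  maskUnion-merge (J ∷ L) (false ∷ s) (b ∷ t) i rewrite maskUnion-merge L s t i with b ∧ J i | maskUnion L s i
  ... | true  | true  = refl
  ... | true  | false = refl
  ... | false | _     = refl

  maskSize-merge : ∀ L s t → maskSize L (merge L s t) ≡ maskSize L s + maskSize (unsel L s) t
  maskSize-merge []      s           t       = refl
  maskSize-merge (J ∷ L) []          t       = refl
  maskSize-merge (J ∷ L) (true ∷ s)  t       = cong suc (maskSize-merge L s t)
  maskSize-merge (J ∷ L) (false ∷ s) []      =
    trans (maskSize-merge L s []) (cong (maskSize L s +_) (maskSize-[] (unsel L s)))
  maskSize-merge (J ∷ L) (false ∷ s) (b ∷ t) = begin
    ind b + maskSize L (merge L s t)               ≡⟨ cong (ind b +_) (maskSize-merge L s t) ⟩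
    ind b + (maskSize L s + maskSize (unsel L s) t) ≡⟨ sym (+-assoc (ind b) _ _) ⟩
    (ind b + maskSize L s) + maskSize (unsel L s) t ≡⟨ cong (_+ maskSize (unsel L s) t) (+-comm (ind b) _) ⟩
    (maskSize L s + ind b) + maskSize (unsel L s) t ≡⟨ +-assoc (maskSize L s) (ind b) _ ⟩
    maskSize L s + (ind b + maskSize (unsel L s) t) ∎
    where open ≡-Reasoning

  interleave : List Bool → List (Fin r) → List (Fin r) → List (Fin r)
  interleave []          xs       ys       = ys
  interleave (true ∷ s)  []       ys       = ys
  interleave (true ∷ s)  (x ∷ xs) ys       = x ∷ interleave s xs ys
  interleave (false ∷ s) xs       []       = xs
  interleave (false ∷ s) xs       (y ∷ ys) = y ∷ interleave s xs ys

  Reps-interleave : ∀ L s {xs ys} → Reps (sel L s) xs → Reps (unsel L s) ys → Reps L (interleave s xs ys)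
  Reps-interleave []      []          []       []       = []
  Reps-interleave []      (true ∷ s)  []       []       = []
  Reps-interleave []      (false ∷ s) []       []       = []
  Reps-interleave (J ∷ L) []          []       q        = q
  Reps-interleave (J ∷ L) (true ∷ s)  (p ∷ ps) q        = p ∷ Reps-interleave L s ps q
  Reps-interleave (J ∷ L) (false ∷ s) ps       (q ∷ qs) = q ∷ Reps-interleave L s ps qs

  All-interleave : ∀ {P : Fin r → Set} s xs ys → All P xs → All P ys → All P (interleave s xs ys)
  All-interleave []          xs       ys       a       b       = b
  All-interleave (true ∷ s)  []       ys       a       b       = b
  All-interleave (true ∷ s)  (x ∷ xs) ys       (p ∷ a) b       = p ∷ All-interleave s xs ys a b
  All-interleave (false ∷ s) xs       []       a       b       = a
  All-interleave (false ∷ s) xs       (y ∷ ys) a       (q ∷ b) = q ∷ All-interleave s xs ys a b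

  Unique-interleave : ∀ (U : Fin r → Bool) s xs ys → Unique xs → Unique ys →
                      All (λ j → U j ≡ true) xs → All (λ j → U j ≡ false) ys → Unique (interleave s xs ys)
  Unique-interleave U []          xs       ys       ux        uy        _       _       = uy
  Unique-interleave U (true ∷ s)  []       ys       ux        uy        _       _       = uy
  Unique-interleave U (true ∷ s)  (x ∷ xs) ys       (ax ∷ ux) uy        (p ∷ a) b       =
    All-interleave s xs ys ax (All.map (λ q e → true≢false (trans (sym p) (trans (cong U e) q))) b)
    ∷ Unique-interleave U s xs ys ux uy a b
  Unique-interleave U (false ∷ s) xs       []       ux        uy        _       _       = ux
  Unique-interleave U (false ∷ s) xs       (y ∷ ys) ux        (ay ∷ uy) a       (q ∷ b) =
    All-interleave s xs ys (All.map (λ p e → true≢false (trans (sym p) (trans (cong U (sym e)) q))) a) ay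
    ∷ Unique-interleave U s xs ys ux uy a b

  Reps-sel-⊆ : ∀ L s {js} → Reps (sel L s) js → All (λ j → maskUnion L s j ≡ true) js
  Reps-sel-⊆ []      s           []       = []
  Reps-sel-⊆ (J ∷ L) []          []       = []
  Reps-sel-⊆ (J ∷ L) (true ∷ s)  (p ∷ ps) = ∨-introˡ _ p ∷ All.map (λ {j} q → ∨-introʳ (J j) q) (Reps-sel-⊆ L s ps)
  Reps-sel-⊆ (J ∷ L) (false ∷ s) ps       = Reps-sel-⊆ L s ps

  hall-sel : ∀ I L′ s → HallCondition (I ∷ L′) → HallCondition (sel L′ s)
  hall-sel I L′ s H t = subst₂ _≤_ (maskSize-liftMask L′ s t) (countF-cong (maskUnion-liftMask L′ s t))
                                   (H (false ∷ liftMask L′ s t))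

  hall-complement : ∀ I L′ s → HallCondition (I ∷ L′) → countF (maskUnion L′ s) ≤ maskSize L′ s →
                    HallCondition (map (minus (maskUnion L′ s)) (I ∷ unsel L′ s))
  hall-complement I L′ s H crit = hall-minus U (I ∷ R) bound
    where
    U = maskUnion L′ s
    c = maskSize L′ s
    R = unsel L′ s
    bound : ∀ t → maskSize (I ∷ R) t ≤ countF (λ i → maskUnion (I ∷ R) t i ∧ not (U i))
    bound []       = z≤n
    bound (b ∷ t′) = +-cancelʳ-≤ c _ _ (begin
      (ind b + maskSize R t′) + c        ≡⟨ +-assoc (ind b) _ c ⟩
      ind b + (maskSize R t′ + c)        ≡⟨ cong (ind b +_) (+-comm _ c) ⟩
      ind b + (c + maskSize R t′)        ≡⟨ cong (ind b +_) (sym (maskSize-merge L′ s t′)) ⟩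
      ind b + maskSize L′ (merge L′ s t′) ≤⟨ H (b ∷ merge L′ s t′) ⟩
      countF (λ i → (b ∧ I i) ∨ maskUnion L′ (merge L′ s t′) i)
        ≡⟨ countF-cong (λ i → cong ((b ∧ I i) ∨_) (maskUnion-merge L′ s t′ i)) ⟩
      countF (λ i → (b ∧ I i) ∨ (U i ∨ maskUnion R t′ i)) ≤⟨ countF-≤-+ pointwise ⟩
      X + countF U                       ≤⟨ +-monoʳ-≤ X crit ⟩
      X + c ∎)
      where
      open ≤-Reasoning
      X = countF (λ i → ((b ∧ I i) ∨ maskUnion R t′ i) ∧ not (U i))
      pointwise : ∀ i → ind ((b ∧ I i) ∨ (U i ∨ maskUnion R t′ i)) ≤
                        ind (((b ∧ I i) ∨ maskUnion R t′ i) ∧ not (U i)) + ind (U i)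
      pointwise i with b ∧ I i | U i | maskUnion R t′ i
      ... | true  | true  | _     = s≤s z≤n
      ... | true  | false | _     = s≤s z≤n
      ... | false | true  | true  = s≤s z≤n
      ... | false | true  | false = s≤s z≤n
      ... | false | false | true  = s≤s z≤n
      ... | false | false | false = z≤n

  -- Case 2: L′ has a nonempty critical subfamily K = sel L′ s with union U.
  -- Represent K inside U and the rest (with U deleted) outside U, then interleave.
  hall-critical : ∀ {k} → HallUpTo k → ∀ I L′ → length L′ ≤ k → HallCondition (I ∷ L′) →
                  ∀ s → 0 < maskSize L′ s → countF (maskUnion L′ s) ≤ maskSize L′ s → SDR (I ∷ L′)
  hall-critical {k} ih I L′ len H s pos crit =
    combine (ih (sel L′ s) lenK (hall-sel I L′ s H))
            (ih (map (minus U) (I ∷ R)) lenRest (hall-complement I L′ s H crit))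
    where
    U = maskUnion L′ s
    R = unsel L′ s
    lenK : length (sel L′ s) ≤ k
    lenK = ≤-trans (m≤m+n _ (length R)) (subst (_≤ k) (sym (length-sel+unsel L′ s)) len)
    lenRest : length (map (minus U) (I ∷ R)) ≤ k
    lenRest = ≤-trans (≤-reflexive (ListP.length-map (minus U) (I ∷ R)))
                (≤-trans (+-monoˡ-≤ (length R) (subst (0 <_) (sym (length-sel L′ s)) pos))
                         (subst (_≤ k) (sym (length-sel+unsel L′ s)) len))
    combine : SDR (sel L′ s) → SDR (map (minus U) (I ∷ R)) → SDR (I ∷ L′)
    combine _ ([] , () , _)
    combine (xs , repsK , uniqueK) (y ∷ ys , py ∷ psRest , ay ∷ uniqueRest)
      with Reps-minus U (I ∷ R) (py ∷ psRest)
    ... | Iy ∷ repsR , Uy ∷ outsideU =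
      y ∷ interleave s xs ys ,
      Iy ∷ Reps-interleave L′ s repsK repsR ,
      All-interleave s xs ys (All.map (λ q e → true≢false (trans (sym q) (trans (cong U (sym e)) Uy))) insideU) ay
      ∷ Unique-interleave U s xs ys uniqueK uniqueRest insideU outsideU
      where
      insideU = Reps-sel-⊆ L′ s repsK

  hall-upTo : ∀ k → HallUpTo k
  hall-upTo k       []       _         _ = [] , [] , []
  hall-upTo (suc k) (I ∷ L′) (s≤s len) H
    with searchMasks (length L′) (λ s → (0 <ᵇ maskSize L′ s) ∧ (countF (maskUnion L′ s) <ᵇ suc (maskSize L′ s)))
  ... | inj₁ (s , critical) =
    hall-critical (hall-upTo k) I L′ len H s (<ᵇ-true 0 _ (∧-trueˡ critical))
      (≤-pred (<ᵇ-true _ _ (∧-trueʳ {0 <ᵇ maskSize L′ s} critical)))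
  ... | inj₂ noCritical = hall-surplus (hall-upTo k) I L′ len H surplus
    where
    surplus : ∀ t → 0 < maskSize L′ t → maskSize L′ t < countF (maskUnion L′ t)
    surplus t pos = subst₂ _<_ (maskSize-fit L′ t) (countF-cong (maskUnion-fit L′ t))
      (<ᵇ-false _ _ (∧-falseʳ (noCritical (fit L′ t) (length-fit L′ t))
                              (<ᵇ-intro (subst (0 <_) (sym (maskSize-fit L′ t)) pos))))

  hall : ∀ L → HallCondition L → SDR L
  hall L = hall-upTo (length L) L ≤-refl

open HallTheorem

extractRep : ∀ {k} (J : Sub k) L js → Reps (map lookup L) js → Unique js → memL J L ≡ true →
  Σ (Fin k) λ j → Σ (List (Fin k)) λ js′ →
    lookup J j ≡ true × Reps (map lookup (removeOne J L)) js′ × Unique js′ ×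
    j ∉ js′ × (∀ {i} → i ∈ js′ → i ∈ js) × j ∈ js
extractRep J (J′ ∷ L) (j′ ∷ js) (p ∷ rs) (a ∷ u) m with eqSub J J′ in e
... | true = j′ , js , subst (λ z → lookup z j′ ≡ true) (sym (eqSub-true {u = J} {J′} e)) p , rs , u ,
             (λ m′ → All.lookup a m′ refl) , there , here refl
... | false with extractRep J L js rs u m
...   | j , js′ , pj , rs′ , u′ , j∉ , ⊆js , j∈ =
  j , j′ ∷ js′ , pj , p ∷ rs′ , All.tabulate (λ m′ → All.lookup a (⊆js m′)) ∷ u′ , j∉′ , ⊆js′ , there j∈
  where
  j∉′ : j ∉ j′ ∷ js′
  j∉′ (here eq)  = All.lookup a j∈ (sym eq)
  j∉′ (there m′) = j∉ m′
  ⊆js′ : ∀ {i} → i ∈ j′ ∷ js′ → i ∈ j′ ∷ js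
  ⊆js′ (here eq)  = here eq
  ⊆js′ (there m′) = there (⊆js m′)

transferReps : ∀ {k} (L′ L : List (Sub k)) js → SameCounts L L′ → Reps (map lookup L) js → Unique js →
  Σ (List (Fin k)) λ js′ → Reps (map lookup L′) js′ × Unique js′ × (∀ {i} → i ∈ js′ → i ∈ js)
transferReps []       L js ce rs u = [] , [] , [] , λ ()
transferReps (J ∷ L′) L js ce rs u with extractRep J L js rs u (sameCounts-mem J L L′ ce)
... | j , js₀ , pj , rs₀ , u₀ , j∉ , ⊆js , j∈
  with transferReps L′ (removeOne J L) js₀ (sameCounts-removeOne J L L′ ce) rs₀ u₀
...   | js′ , rs′ , u′ , ⊆js₀ =
  j ∷ js′ , pj ∷ rs′ , All.tabulate (λ m e → j∉ (subst (_∈ js₀) (sym e) (⊆js₀ m))) ∷ u′ , ⊆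
  where
  ⊆ : ∀ {i} → i ∈ j ∷ js′ → i ∈ js
  ⊆ (here refl) = j∈
  ⊆ (there m)   = ⊆js (⊆js₀ m)

sdr-sameCounts : ∀ {k} (L′ L : List (Sub k)) → SameCounts L L′ → SDR (map lookup L) → SDR (map lookup L′)
sdr-sameCounts L′ L ce (js , rs , u) with transferReps L′ L js ce rs u
... | js′ , rs′ , u′ , _ = js′ , rs′ , u′

vecMask : ∀ {k} (L : List (Sub k)) → List Bool → Vec Bool (length L)
vecMask []      t       = []
vecMask (J ∷ L) []      = false ∷ vecMask L []
vecMask (J ∷ L) (b ∷ t) = b ∷ vecMask L t

lookup-emptySub : ∀ {k} (i : Fin k) → lookup (emptySub {k}) i ≡ false
lookup-emptySub i = VecP.lookup∘tabulate (λ _ → false) i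

lookup-unionSub : ∀ {k} (u v : Sub k) i → lookup (unionSub u v) i ≡ (lookup u i ∨ lookup v i)
lookup-unionSub u v i = VecP.lookup∘tabulate (λ i → lookup u i ∨ lookup v i) i

selUnion-toList : ∀ {k} (L : List (Sub k)) (v : Vec Bool (length L)) i →
                  lookup (selUnion L v) i ≡ maskUnion (map lookup L) (toList v) i
selUnion-toList []      []          i = lookup-emptySub i
selUnion-toList (J ∷ L) (true ∷ v)  i =
  trans (lookup-unionSub J (selUnion L v) i) (cong (lookup J i ∨_) (selUnion-toList L v i))
selUnion-toList (J ∷ L) (false ∷ v) i = selUnion-toList L v i

selCount-toList : ∀ {k} (L : List (Sub k)) (v : Vec Bool (length L)) →
                  selCount L v ≡ maskSize (map lookup L) (toList v)
selCount-toList []      []      = refl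
selCount-toList (J ∷ L) (b ∷ v) = cong (ind b +_) (selCount-toList L v)

selUnion-vecMask : ∀ {k} (L : List (Sub k)) t i → lookup (selUnion L (vecMask L t)) i ≡ maskUnion (map lookup L) t i
selUnion-vecMask []      t          i = lookup-emptySub i
selUnion-vecMask (J ∷ L) []         i = trans (selUnion-vecMask L [] i) (maskUnion-[] (map lookup L) i)
selUnion-vecMask (J ∷ L) (true ∷ t) i =
  trans (lookup-unionSub J (selUnion L (vecMask L t)) i) (cong (lookup J i ∨_) (selUnion-vecMask L t i))
selUnion-vecMask (J ∷ L) (false ∷ t) i = selUnion-vecMask L t i

selCount-vecMask : ∀ {k} (L : List (Sub k)) t → selCount L (vecMask L t) ≡ maskSize (map lookup L) t
selCount-vecMask []      t       = refl
selCount-vecMask (J ∷ L) []      = trans (selCount-vecMask L []) (maskSize-[] (map lookup L))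
selCount-vecMask (J ∷ L) (b ∷ t) = cong (ind b +_) (selCount-vecMask L t)

xor-true⇒false : ∀ {a} → (a xor true) ≡ true → a ≡ false
xor-true⇒false {false} _ = refl

valid⇒hall : ∀ {k} (L : List (Sub k)) → valid L ≡ true → HallCondition (map lookup L)
valid⇒hall {k} L v t = subst₂ _≤_ (selCount-vecMask L t) (countF-cong (selUnion-vecMask L t))
  (<ᵇ-false _ _ (xor-true⇒false (all-elim _ (allSubs (length L)) v w (allSubs-complete w))))
  where w = vecMask L t

hall⇒valid : ∀ {k} (L : List (Sub k)) → HallCondition (map lookup L) → valid L ≡ true
hall⇒valid {k} L H = all-intro _ (allSubs (length L)) λ w _ → noDeficiency w
  where
  noDeficiency : ∀ w → ((card (selUnion L w) <ᵇ selCount L w) xor true) ≡ true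
  noDeficiency w with card (selUnion L w) <ᵇ selCount L w in e
  ... | false = refl
  ... | true  = ⊥-elim (<⇒≱ (<ᵇ-true _ _ e)
      (subst₂ _≤_ (sym (selCount-toList L w)) (sym (countF-cong (selUnion-toList L w))) (H (toList w))))

module Bases {n r : ℕ} (A : Presentation n r) where

  ty : Fin n → Sub r
  ty = φ A

  lookup-ty : ∀ x j → lookup (ty x) j ≡ lookup (lookup A j) x
  lookup-ty x j = VecP.lookup∘tabulate (λ j → lookup (lookup A j) x) j

  elems : Sub n → List (Fin n)
  elems S = filterᵇ (lookup S) (allFin n)

  elems-∈ : ∀ S {x} → lookup S x ≡ true → x ∈ elems S
  elems-∈ S p = ∈-filterᵇ⁺ (lookup S) (allFin n) (∈-allFin _) p

  elems-∈⁻ : ∀ S {x} → x ∈ elems S → lookup S x ≡ true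
  elems-∈⁻ S m = ∈-filterᵇ⁻ (lookup S) (allFin n) m

  elems-unique : ∀ S → Unique (elems S)
  elems-unique S = UniqueP.filter⁺ (T? ∘ lookup S) (UniqueP.allFin⁺ n)

  All-elems : ∀ S → All (λ x → lookup S x ≡ true) (elems S)
  All-elems S = All.tabulate (elems-∈⁻ S)

  length-elems : ∀ S → length (elems S) ≡ countF (lookup S)
  length-elems S = begin
    length (elems S)                           ≡⟨ sym (countL-true (elems S)) ⟩
    countL (λ _ → true) (elems S)              ≡⟨ countL-filterᵇ (λ _ → true) (lookup S) (allFin n) ⟩
    countL (λ x → lookup S x ∧ true) (allFin n) ≡⟨ countL-tabulate id (λ x → lookup S x ∧ true) ⟩
    countF (λ x → lookup S x ∧ true)           ≡⟨ countF-cong (λ x → BoolP.∧-identityʳ (lookup S x)) ⟩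
    countF (lookup S) ∎
    where open ≡-Reasoning

  mult≡cnt : ∀ S I → mult A S I ≡ cnt I (typeList A S)
  mult≡cnt S I = sym (begin
    countL (λ J → eqSub J I) (map ty (elems S))            ≡⟨ countL-map (λ J → eqSub J I) ty (elems S) ⟩
    countL (λ x → eqSub (ty x) I) (elems S)                ≡⟨ countL-filterᵇ _ (lookup S) (allFin n) ⟩
    countL (λ x → lookup S x ∧ eqSub (ty x) I) (allFin n)  ≡⟨ countL-tabulate {k = n} id _ ⟩
    countF (λ x → lookup S x ∧ eqSub (ty x) I) ∎)
    where open ≡-Reasoning

  data ElemReps : List (Fin n) → List (Fin r) → Set where
    []  : ElemReps [] []
    _∷_ : ∀ {x xs j js} → lookup (ty x) j ≡ true → ElemReps xs js → ElemReps (x ∷ xs) (j ∷ js)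

  ElemReps⇒Reps : ∀ {xs js} → ElemReps xs js → Reps (map lookup (map ty xs)) js
  ElemReps⇒Reps []      = []
  ElemReps⇒Reps (p ∷ e) = p ∷ ElemReps⇒Reps e

  Reps⇒ElemReps : ∀ xs {js} → Reps (map lookup (map ty xs)) js → ElemReps xs js
  Reps⇒ElemReps []       []      = []
  Reps⇒ElemReps (x ∷ xs) (p ∷ e) = p ∷ Reps⇒ElemReps xs e

  length-ElemReps : ∀ {xs js} → ElemReps xs js → length xs ≡ length js
  length-ElemReps []      = refl
  length-ElemReps (_ ∷ e) = cong suc (length-ElemReps e)

  Transversal : Sub n → Set
  Transversal S = Σ (Fin r → Fin n) λ f →
      (∀ i j → f i ≡ f j → i ≡ j) × (∀ j → lookup (lookup A j) (f j) ≡ true) ×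
      (∀ x → lookup S x ≡ true → ∃ λ j → f j ≡ x) × (∀ j → lookup S (f j) ≡ true)

  isBase⇒transversal : ∀ S → isBase A S ≡ true → Transversal S
  isBase⇒transversal S b with any-elim _ (allMaps n r) b
  ... | v , _ , c = lookup v , injective , inA , onto , into
    where
    distinct = allF-elim _ (∧-trueˡ c)
    rest = ∧-trueʳ {allF (λ i → allF (λ j → eqFin i j ∨ not (eqFin (lookup v i) (lookup v j))))} c
    inA = allF-elim _ (∧-trueˡ rest)
    image = allF-elim _ (∧-trueʳ {allF (λ j → lookup (lookup A j) (lookup v j))} rest)
    injective : ∀ i j → lookup v i ≡ lookup v j → i ≡ j
    injective i j e with ∨-elim {eqFin i j} (allF-elim _ (distinct i) j)
    ... | inj₁ q = eqFin-true q
    ... | inj₂ q = ⊥-elim (true≢false (trans (sym (subst (λ z → eqFin (lookup v i) z ≡ true) e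
                                                        (eqFin-refl (lookup v i)))) (not-true⇒false q)))
    onto : ∀ x → lookup S x ≡ true → ∃ λ j → lookup v j ≡ x
    onto x p with anyF-elim _ (trans (sym (eqBool-true (image x))) p)
    ... | j , q = j , eqFin-true q
    into : ∀ j → lookup S (lookup v j) ≡ true
    into j = trans (eqBool-true (image (lookup v j))) (anyF-intro _ j (eqFin-refl (lookup v j)))

  transversal⇒isBase : ∀ S → Transversal S → isBase A S ≡ true
  transversal⇒isBase S (f , injective , inA , onto , into) =
    any-intro _ (allMaps n r) (allMaps-complete r v) (∧-intro distinct (∧-intro inA′ image))
    where
    v = tabulate f
    lv : ∀ i → lookup v i ≡ f i
    lv i = VecP.lookup∘tabulate f i
    distinct : allF (λ i → allF (λ j → eqFin i j ∨ not (eqFin (lookup v i) (lookup v j)))) ≡ true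
    distinct = allF-intro _ λ i → allF-intro _ λ j → pair i j
      where
      pair : ∀ i j → (eqFin i j ∨ not (eqFin (lookup v i) (lookup v j))) ≡ true
      pair i j rewrite lv i | lv j with i Fin.≟ j
      ... | yes _ = refl
      ... | no ne = false⇒not-true (eqFin-false (ne ∘ injective i j))
    inA′ : allF (λ j → lookup (lookup A j) (lookup v j)) ≡ true
    inA′ = allF-intro _ λ j → subst (λ z → lookup (lookup A j) z ≡ true) (sym (lv j)) (inA j)
    image : allF (λ x → eqBool (lookup S x) (anyF (λ j → eqFin (lookup v j) x))) ≡ true
    image = allF-intro _ point
      where
      point : ∀ x → eqBool (lookup S x) (anyF (λ j → eqFin (lookup v j) x)) ≡ true
      point x with lookup S x in e
      ... | true with onto x e
      ...   | j , q = cong (eqBool true) (anyF-intro (λ j → eqFin (lookup v j) x) j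
                        (subst (λ z → eqFin z x ≡ true) (sym (trans (lv j) q)) (eqFin-refl x)))
      point x | false with anyF (λ j → eqFin (lookup v j) x) in e′
      ... | false = refl
      ... | true with anyF-elim _ e′
      ...   | j , q = ⊥-elim (true≢false (trans (sym (into j))
                        (trans (cong (lookup S) (trans (sym (lv j)) (eqFin-true q))) e)))

  module _ (S : Sub n) (tr : Transversal S) where
    private
      f = proj₁ tr
      injective = proj₁ (proj₂ tr)
      inA = proj₁ (proj₂ (proj₂ tr))
      onto = proj₁ (proj₂ (proj₂ (proj₂ tr)))
      into = proj₂ (proj₂ (proj₂ (proj₂ tr)))

    indices : ∀ xs → All (λ x → lookup S x ≡ true) xs → List (Fin r)
    indices []       []       = []
    indices (x ∷ xs) (p ∷ ps) = proj₁ (onto x p) ∷ indices xs ps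

    indices-reps : ∀ xs ps → ElemReps xs (indices xs ps)
    indices-reps []       []       = []
    indices-reps (x ∷ xs) (p ∷ ps) =
      trans (lookup-ty x _) (subst (λ z → lookup (lookup A (proj₁ (onto x p))) z ≡ true) (proj₂ (onto x p)) (inA _))
      ∷ indices-reps xs ps

    indices-avoid : ∀ {x} j → f j ≡ x → ∀ xs ps → All (x ≢_) xs → All (j ≢_) (indices xs ps)
    indices-avoid j e []       []       _          = []
    indices-avoid j e (y ∷ ys) (p ∷ ps) (ne ∷ nes) =
      (λ q → ne (trans (sym e) (trans (cong f q) (proj₂ (onto y p))))) ∷ indices-avoid j e ys ps nes

    indices-unique : ∀ xs ps → Unique xs → Unique (indices xs ps)
    indices-unique []       []       _       = []
    indices-unique (x ∷ xs) (p ∷ ps) (a ∷ u) =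
      indices-avoid (proj₁ (onto x p)) (proj₂ (onto x p)) xs ps a ∷ indices-unique xs ps u

    length-indices : ∀ xs ps → length (indices xs ps) ≡ length xs
    length-indices []       []       = refl
    length-indices (x ∷ xs) (p ∷ ps) = cong suc (length-indices xs ps)

    transversal⇒sdr : SDR (map lookup (typeList A S))
    transversal⇒sdr = indices (elems S) (All-elems S) ,
                      ElemReps⇒Reps (indices-reps _ _) , indices-unique _ _ (elems-unique S)

    transversal-size : length (elems S) ≡ r
    transversal-size = ≤-antisym atMost atLeast
      where
      atMost : length (elems S) ≤ r
      atMost = subst₂ _≤_ (length-indices _ (All-elems S)) (countF-true {r})
        (unique-length≤countF (λ _ → true) (indices (elems S) (All-elems S))
          (indices-unique _ _ (elems-unique S)) (All.tabulate (λ _ → refl)))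
      fInS : ∀ {x} → x ∈ map f (allFin r) → lookup S x ≡ true
      fInS m with ∈-map⁻ f m
      ... | j , _ , e = subst (λ z → lookup S z ≡ true) (sym e) (into j)
      atLeast : r ≤ length (elems S)
      atLeast = subst₂ _≤_ (trans (ListP.length-map f (allFin r)) (ListP.length-tabulate {n = r} id))
                           (sym (length-elems S))
        (unique-length≤countF (lookup S) (map f (allFin r))
          (UniqueP.map⁺ (λ {i} {j} → injective i j) (UniqueP.allFin⁺ r)) (All.tabulate fInS))

  -- Conversely, an SDR of the r types of S gives a transversal: the set A_k
  -- is matched to the element whose representative is k.
  elementOf : ∀ {xs js} → ElemReps xs js → (k : Fin r) → k ∈ js → Fin n
  elementOf (_∷_ {x = x} p e) k (here _)  = x
  elementOf (p ∷ e)           k (there m) = elementOf e k m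

  elementOf-rep : ∀ {xs js} (e : ElemReps xs js) k m → lookup (ty (elementOf e k m)) k ≡ true
  elementOf-rep (p ∷ e) k (here refl) = p
  elementOf-rep (p ∷ e) k (there m)   = elementOf-rep e k m

  elementOf-∈ : ∀ {xs js} (e : ElemReps xs js) k m → elementOf e k m ∈ xs
  elementOf-∈ (p ∷ e) k (here _)  = here refl
  elementOf-∈ (p ∷ e) k (there m) = there (elementOf-∈ e k m)

  elementOf-injective : ∀ {xs js} (e : ElemReps xs js) → Unique xs →
                        ∀ k k′ m m′ → elementOf e k m ≡ elementOf e k′ m′ → k ≡ k′
  elementOf-injective (p ∷ e) u       k k′ (here q)  (here q′)  eq = trans q (sym q′)
  elementOf-injective (p ∷ e) (a ∷ u) k k′ (here q)  (there m′) eq = ⊥-elim (All.lookup a (elementOf-∈ e k′ m′) eq)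
  elementOf-injective (p ∷ e) (a ∷ u) k k′ (there m) (here q′)  eq = ⊥-elim (All.lookup a (elementOf-∈ e k m) (sym eq))
  elementOf-injective (p ∷ e) (a ∷ u) k k′ (there m) (there m′) eq = elementOf-injective e u k k′ m m′ eq

  elementOf-onto : ∀ {xs js} (e : ElemReps xs js) → Unique js → ∀ {x} → x ∈ xs →
                   ∃ λ k → k ∈ js × (∀ m → elementOf e k m ≡ x)
  elementOf-onto (_∷_ {j = j} p e) (a ∷ u) (here refl) = j , here refl , atHead
    where
    atHead : ∀ m → elementOf (p ∷ e) j m ≡ _
    atHead (here _)  = refl
    atHead (there m) = ⊥-elim (All.lookup a m refl)
  elementOf-onto (p ∷ e) (a ∷ u) (there mx) with elementOf-onto e u mx
  ... | k , k∈ , g = k , there k∈ , inTail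
    where
    inTail : ∀ m → elementOf (p ∷ e) k m ≡ _
    inTail (here q)  = ⊥-elim (All.lookup a k∈ (sym q))
    inTail (there m) = g m

  unique-full : ∀ js → length js ≡ r → Unique js → ∀ k → k ∈ js
  unique-full js len u k with DecMembership._∈?_ (FinP._≟_ {r}) k js
  ... | yes m = m
  ... | no k∉ = ⊥-elim (1+n≰n (subst (_≤ countF (λ i → true ∧ not (eqFin i k))) (trans len (sym len′)) bound))
    where
    len′ : suc (countF (λ i → true ∧ not (eqFin i k))) ≡ r
    len′ = trans (sym (countF-remove (λ _ → true) k refl)) (countF-true {r})
    bound : length js ≤ countF (λ i → true ∧ not (eqFin i k))
    bound = unique-length≤countF _ js u
      (All.tabulate λ m → false⇒not-true (eqFin-false (λ e → k∉ (subst (_∈ js) e m))))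

  sdr⇒transversal : ∀ S {js} → length (elems S) ≡ r → ElemReps (elems S) js → Unique js → Transversal S
  sdr⇒transversal S {js} len e u = f , injective , inA , onto , into
    where
    full : ∀ k → k ∈ js
    full = unique-full js (trans (sym (length-ElemReps e)) len) u
    f : Fin r → Fin n
    f k = elementOf e k (full k)
    injective : ∀ i j → f i ≡ f j → i ≡ j
    injective i j = elementOf-injective e (elems-unique S) i j _ _
    inA : ∀ j → lookup (lookup A j) (f j) ≡ true
    inA j = trans (sym (lookup-ty (f j) j)) (elementOf-rep e j _)
    onto : ∀ x → lookup S x ≡ true → ∃ λ j → f j ≡ x
    onto x p with elementOf-onto e u (elems-∈ S p)
    ... | k , _ , g = k , g _
    into : ∀ j → lookup S (f j) ≡ true
    into j = elems-∈⁻ S (elementOf-∈ e j _)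

  valid⇒transversal : ∀ S (L : List (Sub r)) → SameCounts L (typeList A S) →
                      valid L ≡ true → length L ≡ r → Transversal S
  valid⇒transversal S L ce v len with sdr-sameCounts (typeList A S) L ce (hall (map lookup L) (valid⇒hall L v))
  ... | js , rs , u = sdr⇒transversal S sizeS (Reps⇒ElemReps (elems S) rs) u
    where
    sizeS : length (elems S) ≡ r
    sizeS = trans (sym (ListP.length-map ty (elems S))) (trans (sym (sameCounts-length (typeList A S) L ce)) len)

  transversal⇒valid : ∀ S (L : List (Sub r)) → SameCounts L (typeList A S) →
                      Transversal S → valid L ≡ true × length L ≡ r
  transversal⇒valid S L ce tr =
    hall⇒valid L (sdr⇒hall (map lookup L) (sdr-sameCounts L (typeList A S) (sym ∘ ce) (transversal⇒sdr S tr))) ,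
    trans (sameCounts-length (typeList A S) L ce) (trans (ListP.length-map ty (elems S)) (transversal-size S tr))

lexLt-total : ∀ {k} (u v : Sub k) → u ≢ v → lexLt u v ≡ false → lexLt v u ≡ true
lexLt-total []          []          ne h  = ⊥-elim (ne refl)
lexLt-total (true ∷ u)  (true ∷ v)  ne h  = lexLt-total u v (ne ∘ cong (true ∷_)) h
lexLt-total (false ∷ u) (false ∷ v) ne h  = lexLt-total u v (ne ∘ cong (false ∷_)) h
lexLt-total (false ∷ u) (true ∷ v)  ne h  = refl

≺-total : ∀ {k} (u v : Sub k) → u ≢ v → (u ≺ v) ≡ false → (v ≺ u) ≡ true
≺-total u v ne h with <-cmp (card u) (card v)
... | tri< lt _ _ = ⊥-elim (true≢false (trans (sym (∨-introˡ ((card u ≡ᵇ card v) ∧ lexLt u v) (<ᵇ-intro lt))) h))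
... | tri> _ _ gt = ∨-introˡ _ (<ᵇ-intro gt)
... | tri≈ _ eq _ = ∨-introʳ (card v <ᵇ card u)
      (∧-intro (subst (λ z → (card v ≡ᵇ z) ≡ true) (sym eq) (≡ᵇ-refl (card v)))
               (lexLt-total u v ne (noLex (card u <ᵇ card v) h)))
  where
  sameCard : (card u ≡ᵇ card v) ≡ true
  sameCard = subst (λ z → (z ≡ᵇ card v) ≡ true) (sym eq) (≡ᵇ-refl (card v))
  noLex : ∀ b → (b ∨ ((card u ≡ᵇ card v) ∧ lexLt u v)) ≡ false → lexLt u v ≡ false
  noLex false h′ = ∧-falseʳ h′ sameCard

-- countBelow P x = |{ y < x : P y }|.  Keeping, in a class P, the elements
-- with fewer than a smaller members of P keeps its a smallest members.

countBelow : ∀ {k} → (Fin k → Bool) → Fin k → ℕ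
countBelow P zero    = 0
countBelow P (suc x) = ind (P zero) + countBelow (P ∘ suc) x

countBelow-cong : ∀ {k} {P Q : Fin k → Bool} → (∀ i → P i ≡ Q i) → ∀ x → countBelow P x ≡ countBelow Q x
countBelow-cong e zero    = refl
countBelow-cong e (suc x) = cong₂ _+_ (cong ind (e zero)) (countBelow-cong (e ∘ suc) x)

countBelow-< : ∀ {k} (P : Fin k → Bool) {x y : Fin k} → x Fin.< y → P x ≡ true → countBelow P x < countBelow P y
countBelow-< P {zero}  {suc y} lt       px rewrite px = s≤s z≤n
countBelow-< P {suc x} {suc y} (s≤s lt) px = +-monoʳ-< (ind (P zero)) (countBelow-< (P ∘ suc) lt px)

<ᵇ-zero : ∀ m → (m <ᵇ 0) ≡ false
<ᵇ-zero zero    = refl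
<ᵇ-zero (suc m) = refl

countF-initial : ∀ {k} (P : Fin k → Bool) a → countF (λ x → P x ∧ (countBelow P x <ᵇ a)) ≡ a ⊓ countF P
countF-initial {zero}  P a = sym (⊓-zeroʳ a)
countF-initial {suc k} P a with P zero
countF-initial {suc k} P zero    | true  = trans
  (countF-cong (λ i → trans (cong (P (suc i) ∧_) (<ᵇ-zero (suc (countBelow (P ∘ suc) i)))) (BoolP.∧-zeroʳ _)))
  (countF-false {k})
countF-initial {suc k} P (suc a) | true  = cong suc (countF-initial (P ∘ suc) a)
countF-initial {suc k} P a       | false = countF-initial (P ∘ suc) a

module Exchange {n r : ℕ} (A : Presentation n r) where
  open Bases A

  exchange : Sub n → Fin n → Fin n → Sub n
  exchange S e j = tabulate (λ x → (lookup S x ∨ eqFin x e) ∧ not (eqFin x j))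

  lookup-exchange : ∀ S e j x → lookup (exchange S e j) x ≡ ((lookup S x ∨ eqFin x e) ∧ not (eqFin x j))
  lookup-exchange S e j x = VecP.lookup∘tabulate (λ x → (lookup S x ∨ eqFin x e) ∧ not (eqFin x j)) x

  mult-exchange : ∀ S e j → lookup S e ≡ false → lookup S j ≡ true → e ≢ j → ∀ K →
     mult A (exchange S e j) K + ind (eqSub (ty j) K) ≡ mult A S K + ind (eqSub (ty e) K)
  mult-exchange S e j Se Sj e≢j K = begin
    countF (λ x → lookup (exchange S e j) x ∧ t x) + ind (t j)
      ≡⟨ cong₂ _+_ (countF-cong (λ x → cong (_∧ t x) (lookup-exchange S e j x))) (sym (countF-single j t)) ⟩
    countF (λ x → ((lookup S x ∨ eqFin x e) ∧ not (eqFin x j)) ∧ t x) + countF (λ x → eqFin x j ∧ t x)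
      ≡⟨ countF-+-≡ {h = λ x → lookup S x ∧ t x} {e = λ x → eqFin x e ∧ t x} pointwise ⟩
    countF (λ x → lookup S x ∧ t x) + countF (λ x → eqFin x e ∧ t x)
      ≡⟨ cong (countF (λ x → lookup S x ∧ t x) +_) (countF-single e t) ⟩
    mult A S K + ind (t e) ∎
    where
    open ≡-Reasoning
    t : Fin n → Bool
    t x = eqSub (ty x) K
    pointwise : ∀ x → ind (((lookup S x ∨ eqFin x e) ∧ not (eqFin x j)) ∧ t x) + ind (eqFin x j ∧ t x) ≡
                      ind (lookup S x ∧ t x) + ind (eqFin x e ∧ t x)
    pointwise x with eqFin x e in xe | eqFin x j in xj | lookup S x in Sx | t x
    ... | true  | true  | _     | _ = ⊥-elim (e≢j (trans (sym (eqFin-true xe)) (eqFin-true xj)))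
    ... | true  | false | true  | _ = ⊥-elim (true≢false (trans (sym Sx) (trans (cong (lookup S) (eqFin-true xe)) Se)))
    ... | true  | false | false | c = +-identityʳ (ind c)
    ... | false | true  | false | _ = ⊥-elim (true≢false (trans (sym Sj) (trans (cong (lookup S) (sym (eqFin-true xj))) Sx)))
    ... | false | true  | true  | c = sym (+-identityʳ (ind c))
    ... | false | false | true  | c = refl
    ... | false | false | false | c = refl

  exchange-types : ∀ S (L : List (Sub r)) e j → SameCounts L (typeList A S) →
                   lookup S e ≡ false → lookup S j ≡ true → e ≢ j → memL (ty j) L ≡ true →
                   SameCounts (ty e ∷ removeOne (ty j) L) (typeList A (exchange S e j))
  exchange-types S L e j ce Se Sj e≢j mem K = +-cancelʳ-≡ d (q + c) a (begin
    (q + c) + d ≡⟨ +-assoc q c d ⟩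
    q + (c + d) ≡⟨ cong (q +_) removed ⟩
    q + m       ≡⟨ +-comm q m ⟩
    m + q       ≡⟨ sym exchanged ⟩
    a + d ∎)
    where
    open ≡-Reasoning
    a = cnt K (typeList A (exchange S e j))
    c = cnt K (removeOne (ty j) L)
    d = ind (eqSub (ty j) K)
    m = mult A S K
    q = ind (eqSub (ty e) K)
    removed : c + d ≡ m
    removed = trans (cnt-removeOne (ty j) K L mem) (trans (ce K) (sym (mult≡cnt S K)))
    exchanged : a + d ≡ m + q
    exchanged = trans (cong (_+ d) (sym (mult≡cnt (exchange S e j) K))) (mult-exchange S e j Se Sj e≢j K)

  transversal-card : ∀ S → Transversal S → countF (lookup S) ≡ r
  transversal-card S tr = trans (sym (length-elems S)) (transversal-size S tr)

  -- If both S and (S ∪ e) \ j are bases, with e ∉ S, then j ∈ S: otherwise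
  -- the exchange would have one element more than S.
  exchange-removes : ∀ S e j → Transversal S → Transversal (exchange S e j) →
                     lookup S e ≡ false → e ≢ j → lookup S j ≡ true
  exchange-removes S e j trS trX Se e≢j with lookup S j in Sj
  ... | true  = refl
  ... | false = ⊥-elim (<-irrefl refl (subst₂ _<_ (transversal-card S trS) (transversal-card X trX) grows))
    where
    X = exchange S e j
    Xe : lookup X e ≡ true
    Xe = trans (lookup-exchange S e j e)
           (trans (cong₂ (λ a b → (lookup S e ∨ a) ∧ not b) (eqFin-refl e) (eqFin-false e≢j))
                  (cong (_∧ true) (BoolP.∨-zeroʳ (lookup S e))))
    withoutE : ∀ y → (lookup X y ∧ not (eqFin y e)) ≡ lookup S y
    withoutE y rewrite lookup-exchange S e j y with eqFin y e in ye | eqFin y j in yj | lookup S y in Sy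
    ... | true  | _     | true  = ⊥-elim (true≢false (trans (sym Sy) (trans (cong (lookup S) (eqFin-true ye)) Se)))
    ... | true  | _     | false = BoolP.∧-zeroʳ _
    ... | false | true  | true  = ⊥-elim (true≢false (trans (sym Sy) (trans (cong (lookup S) (eqFin-true yj)) Sj)))
    ... | false | true  | false = refl
    ... | false | false | b     = trans (BoolP.∧-identityʳ _) (trans (BoolP.∧-identityʳ _) (BoolP.∨-identityʳ b))
    grows : countF (lookup S) < countF (lookup X)
    grows = subst (countF (lookup S) <_) (sym (countF-remove (lookup X) e Xe))
                  (s≤s (≤-reflexive (sym (countF-cong withoutE))))

  mult-pos : ∀ S j → lookup S j ≡ true → 0 < mult A S (ty j)
  mult-pos S j Sj = subst (0 <_) (sym (countF-remove (λ y → lookup S y ∧ eqSub (ty y) (ty j)) j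
                                                     (∧-intro Sj (eqSub-refl (ty j))))) (s≤s z≤n)

  element-of-type : ∀ S I → 0 < mult A S I → ∃ λ j → lookup S j ≡ true × ty j ≡ I
  element-of-type S I pos with countF-pos _ pos
  ... | j , p = j , ∧-trueˡ p , eqSub-true (∧-trueʳ {lookup S j} p)

-- Bases of the type φ(B), for a presentation labelled compatibly with ≺.

module Passivity {n r : ℕ} (A : Presentation n r)
  (sorted : ∀ (x y : Fin n) → (φ A x ≺ φ A y) ≡ true → x Fin.< y)
  (B : Sub n) (baseB : isBase A B ≡ true) where
  open Bases A
  open Exchange A

  typesB : List (Sub r)
  typesB = typeList A B

  SameType : Sub n → Set
  SameType S = ∀ K → mult A S K ≡ mult A B K

  sameType⇒SameType : ∀ S → sameType A S B ≡ true → SameType S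
  sameType⇒SameType S st K = ≡ᵇ⇒≡ _ _ (≡true⇒T (all-elim _ (allSubs r) st K (allSubs-complete K)))

  SameType⇒sameType : ∀ S → SameType S → sameType A S B ≡ true
  SameType⇒sameType S st = all-intro _ (allSubs r) λ K _ → T⇒≡true (≡⇒≡ᵇ _ _ (st K))

  SameType⇒SameCounts : ∀ S → SameType S → SameCounts typesB (typeList A S)
  SameType⇒SameCounts S st K = trans (sym (mult≡cnt B K)) (trans (sym (st K)) (mult≡cnt S K))

  -- The maximal valid multiset witnessing I ∈ EP is the
  -- type of an exchange (S ∪ x) \ j with x < j, which is therefore a base.
  EP-type⇒passive : ∀ S → Transversal S → SameType S → ∀ x → lookup S x ≡ false →
                    inEP A B (ty x) ≡ true → extPassive A S x ≡ true
  EP-type⇒passive S trS st x Sx inep with any-elim _ (allSubs r) inep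
  ... | I′ , _ , cond with element-of-type S I′ (subst (0 <_) (trans (sym (mult≡cnt B I′)) (sym (st I′)))
                                                     (memL⇒cnt-pos I′ typesB memI′))
    where memI′ = ∧-trueˡ (∧-trueʳ {ty x ≺ I′} cond)
  ...   | j , Sj , refl =
    ∧-intro (false⇒not-true Sx) (anyF-intro _ j (∧-intro (ltFin-intro x<j) (transversal⇒isBase (exchange S x j) trX)))
    where
    x≺j = ∧-trueˡ cond
    memJ = ∧-trueˡ (∧-trueʳ {ty x ≺ ty j} cond)
    validMax = ∧-trueʳ {memL (ty j) typesB} (∧-trueʳ {ty x ≺ ty j} cond)
    x<j : x Fin.< j
    x<j = sorted x j x≺j
    trX : Transversal (exchange S x j)
    trX = valid⇒transversal (exchange S x j) (ty x ∷ removeOne (ty j) typesB)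
            (exchange-types S typesB x j (SameType⇒SameCounts S st) Sx Sj (FinP.<⇒≢ x<j) memJ)
            (∧-trueˡ validMax) (≡ᵇ⇒≡ _ _ (≡true⇒T (∧-trueʳ {valid (ty x ∷ removeOne (ty j) typesB)} validMax)))

  -- The canonical base X of type φ(B): the mult(B,I) smallest elements of each class C_I.
  X : Sub n
  X = tabulate (λ x → countBelow (λ y → eqSub (ty y) (ty x)) x <ᵇ mult A B (ty x))

  lookup-X : ∀ x → lookup X x ≡ (countBelow (λ y → eqSub (ty y) (ty x)) x <ᵇ mult A B (ty x))
  lookup-X x = VecP.lookup∘tabulate (λ x → countBelow (λ y → eqSub (ty y) (ty x)) x <ᵇ mult A B (ty x)) x

  X-sameType : SameType X
  X-sameType K = begin
    countF (λ x → lookup X x ∧ eqSub (ty x) K)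
      ≡⟨ countF-cong pointwise ⟩
    countF (λ x → eqSub (ty x) K ∧ (countBelow (λ y → eqSub (ty y) K) x <ᵇ mult A B K))
      ≡⟨ countF-initial (λ y → eqSub (ty y) K) (mult A B K) ⟩
    mult A B K ⊓ l A K
      ≡⟨ m≤n⇒m⊓n≡m (countF-mono {f = λ x → lookup B x ∧ eqSub (ty x) K} (λ x → ∧-trueʳ {lookup B x})) ⟩
    mult A B K ∎
    where
    open ≡-Reasoning
    pointwise : ∀ x → (lookup X x ∧ eqSub (ty x) K) ≡
                      (eqSub (ty x) K ∧ (countBelow (λ y → eqSub (ty y) K) x <ᵇ mult A B K))
    pointwise x with eqSub (ty x) K in xK
    ... | true  = trans (BoolP.∧-identityʳ _)
                    (trans (lookup-X x) (cong (λ z → countBelow (λ y → eqSub (ty y) z) x <ᵇ mult A B z)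
                                              (eqSub-true {u = ty x} {K} xK)))
    ... | false = BoolP.∧-zeroʳ _

  trB : Transversal B
  trB = isBase⇒transversal B baseB

  -- X is a base, since its type multiset is that of the base B.
  X-transversal : Transversal X
  X-transversal = valid⇒transversal X typesB (SameType⇒SameCounts X X-sameType)
                    (proj₁ validB) (proj₂ validB)
    where validB = transversal⇒valid B typesB (λ K → refl) trB

  X-initial : ∀ e j → lookup X e ≡ false → lookup X j ≡ true → ty e ≡ ty j → e Fin.< j → ⊥
  X-initial e j Xe Xj same e<j = <-irrefl refl (begin-strict
    mult A B (ty j)                            ≡⟨ cong (mult A B) (sym same) ⟩
    mult A B (ty e)                            ≤⟨ <ᵇ-false _ _ (trans (sym (lookup-X e)) Xe) ⟩
    countBelow (λ y → eqSub (ty y) (ty e)) e   ≡⟨ countBelow-cong (λ y → cong (eqSub (ty y)) same) e ⟩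
    countBelow classJ e                        <⟨ countBelow-< classJ e<j
                                                    (subst (λ z → eqSub z (ty j) ≡ true) (sym same) (eqSub-refl (ty j))) ⟩
    countBelow classJ j                        <⟨ <ᵇ-true _ _ (trans (sym (lookup-X j)) Xj) ⟩
    mult A B (ty j) ∎)
    where
    open ≤-Reasoning
    classJ : Fin n → Bool
    classJ y = eqSub (ty y) (ty j)

  exchange-type-≺ : ∀ x j → lookup X x ≡ false → lookup X j ≡ true → x Fin.< j → (ty x ≺ ty j) ≡ true
  exchange-type-≺ x j Xx Xj x<j with eqSub (ty x) (ty j) in xj
  ... | true = ⊥-elim (X-initial x j Xx Xj (eqSub-true xj) x<j)
  ... | false with ty j ≺ ty x in j≺x
  ...   | true  = ⊥-elim (FinP.<-asym x<j (sorted j x j≺x))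
  ...   | false = ≺-total (ty j) (ty x) (eqSub-false xj ∘ sym) j≺x

  passive⇒EP-type : ∀ x → extPassive A X x ≡ true → inEP A B (ty x) ≡ true
  passive⇒EP-type x passive =
    any-intro _ (allSubs r) (allSubs-complete (ty j))
      (∧-intro (exchange-type-≺ x j Xx Xj x<j)
               (∧-intro memJ (∧-intro (proj₁ validMax) (T⇒≡true (≡⇒≡ᵇ _ _ (proj₂ validMax))))))
    where
    Xx : lookup X x ≡ false
    Xx = not-true⇒false (∧-trueˡ passive)
    witness = anyF-elim _ (∧-trueʳ {not (lookup X x)} passive)
    j = proj₁ witness
    x<j : x Fin.< j
    x<j = ltFin-elim (∧-trueˡ (proj₂ witness))
    trX : Transversal (exchange X x j)
    trX = isBase⇒transversal (exchange X x j) (∧-trueʳ {ltFin x j} (proj₂ witness))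
    Xj : lookup X j ≡ true
    Xj = exchange-removes X x j X-transversal trX Xx (FinP.<⇒≢ x<j)
    memJ : memL (ty j) typesB ≡ true
    memJ = cnt-pos⇒memL (ty j) typesB
             (subst (0 <_) (trans (X-sameType (ty j)) (mult≡cnt B (ty j))) (mult-pos X j Xj))
    validMax = transversal⇒valid (exchange X x j) (ty x ∷ removeOne (ty j) typesB)
                 (exchange-types X typesB x j (SameType⇒SameCounts X X-sameType) Xx Xj (FinP.<⇒≢ x<j) memJ) trX

  counted : Sub r → Bool
  counted I = (0 <ᵇ l A I) ∧ inEP A B I

  outsideCounted : Sub n → Fin n → Bool
  outsideCounted S x = not (lookup S x) ∧ counted (ty x)

  outside-class : ∀ S I → countF (λ x → not (lookup S x) ∧ eqSub (ty x) I) ≡ l A I ∸ mult A S I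
  outside-class S I = begin
    countF outside                           ≡⟨ sym (m+n∸m≡n (mult A S I) _) ⟩
    (mult A S I + countF outside) ∸ mult A S I ≡⟨ cong (_∸ mult A S I) split ⟩
    l A I ∸ mult A S I ∎
    where
    open ≡-Reasoning
    t : Fin n → Bool
    t x = eqSub (ty x) I
    outside : Fin n → Bool
    outside x = not (lookup S x) ∧ t x
    split : mult A S I + countF outside ≡ l A I
    split = trans (countF-+-≡ {h = t} {e = λ _ → false} pointwise)
                  (trans (cong (l A I +_) (countF-false {n})) (+-identityʳ _))
      where
      pointwise : ∀ x → ind (lookup S x ∧ t x) + ind (outside x) ≡ ind (t x) + ind false
      pointwise x with lookup S x | t x
      ... | true  | true  = refl
      ... | true  | false = refl
      ... | false | true  = refl
      ... | false | false = refl

  count-class : ∀ S → SameType S → ∀ I →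
                countF (λ x → outsideCounted S x ∧ eqSub (ty x) I) ≡ (if counted I then l A I ∸ mult A B I else 0)
  count-class S st I = trans (countF-cong pointwise) (byCounted (counted I))
    where
    t : Fin n → Bool
    t x = eqSub (ty x) I
    pointwise : ∀ x → (outsideCounted S x ∧ t x) ≡ (counted I ∧ (not (lookup S x) ∧ t x))
    pointwise x with t x in xI
    ... | false = trans (BoolP.∧-zeroʳ _) (sym (trans (cong (counted I ∧_) (BoolP.∧-zeroʳ _)) (BoolP.∧-zeroʳ _)))
    ... | true rewrite eqSub-true {u = ty x} {I} xI with not (lookup S x) | counted I
    ...   | true  | true  = refl
    ...   | true  | false = refl
    ...   | false | c     = sym (BoolP.∧-zeroʳ c)
    byCounted : ∀ b → countF (λ x → b ∧ (not (lookup S x) ∧ t x)) ≡ (if b then l A I ∸ mult A B I else 0)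
    byCounted false = countF-false {n}
    byCounted true  = trans (outside-class S I) (cong (l A I ∸_) (st I))

  count-outsideCounted : ∀ S → SameType S → countF (outsideCounted S) ≡ sumEP A B
  count-outsideCounted S st =
    trans (countF-by-classes (outsideCounted S) ty) (sum-map-cong (allSubs r) (count-class S st))

  sumEP≤ep : ∀ S → Transversal S → SameType S → sumEP A B ≤ ep A S
  sumEP≤ep S trS st = subst (_≤ ep A S) (count-outsideCounted S st)
    (countF-mono (λ x c → EP-type⇒passive S trS st x (not-true⇒false (∧-trueˡ c))
                            (∧-trueʳ {0 <ᵇ l A (ty x)} (∧-trueʳ {not (lookup S x)} c))))

  -- The bound is attained by X: its externally passive elements are exactly
  -- the elements outside X of a counted type.
  ep-X : ep A X ≡ sumEP A B
  ep-X = trans (countF-cong passive≡counted) (count-outsideCounted X X-sameType)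
    where
    nonempty : ∀ x → (0 <ᵇ l A (ty x)) ≡ true
    nonempty x = <ᵇ-intro (subst (0 <_) (sym (countF-remove (λ y → eqSub (ty y) (ty x)) x (eqSub-refl (ty x))))
                                 (s≤s z≤n))
    passive≡counted : ∀ x → extPassive A X x ≡ outsideCounted X x
    passive≡counted x with extPassive A X x in p | outsideCounted X x in c
    ... | true  | true  = refl
    ... | false | false = refl
    ... | true  | false = ⊥-elim (true≢false (trans (sym isCounted) c))
      where
      isCounted : outsideCounted X x ≡ true
      isCounted = ∧-intro (∧-trueˡ {not (lookup X x)} p) (∧-intro (nonempty x) (passive⇒EP-type x p))
    ... | false | true  = ⊥-elim (true≢false (trans (sym isPassive) p))
      where
      isPassive : extPassive A X x ≡ true
      isPassive = EP-type⇒passive X X-transversal X-sameType x (not-true⇒false (∧-trueˡ c))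
                    (∧-trueʳ {0 <ᵇ l A (ty x)} (∧-trueʳ {not (lookup X x)} c))

  X-candidate : (isBase A X ∧ sameType A X B) ≡ true
  X-candidate = ∧-intro (transversal⇒isBase X X-transversal) (SameType⇒sameType X X-sameType)

  sumEP≤candidate : ∀ S → (isBase A S ∧ sameType A S B) ≡ true → sumEP A B ≤ ep A S
  sumEP≤candidate S c = sumEP≤ep S (isBase⇒transversal S (∧-trueˡ c))
                                   (sameType⇒SameType S (∧-trueʳ {isBase A S} c))

epType-minimum : ∀ {n r} (A : Presentation n r) (B : Sub n) (v : ℕ) →
  v ≤ ep A B → (∀ S → (isBase A S ∧ sameType A S B) ≡ true → v ≤ ep A S) →
  ∀ S → (isBase A S ∧ sameType A S B) ≡ true → ep A S ≡ v → epType A B ≡ v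
epType-minimum {n} A B v vB vAll S cS epS = ≤-antisym (≤-trans (belowMember (allSubs n) (allSubs-complete S) cS)
                                                              (≤-reflexive epS))
                                                    (aboveBound (allSubs n))
  where
  candidate : Sub n → Bool
  candidate S = isBase A S ∧ sameType A S B
  step : Sub n → ℕ → ℕ
  step S m = if candidate S then ep A S ⊓ m else m
  belowMember : ∀ Ss {S} → S ∈ Ss → candidate S ≡ true → foldr step (ep A B) Ss ≤ ep A S
  belowMember (S ∷ Ss) (here refl) c rewrite c = m⊓n≤m (ep A S) _
  belowMember (S′ ∷ Ss) (there m) c with candidate S′
  ... | true  = ≤-trans (m⊓n≤n (ep A S′) _) (belowMember Ss m c)
  ... | false = belowMember Ss m c
  aboveBound : ∀ Ss → v ≤ foldr step (ep A B) Ss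
  aboveBound []       = vB
  aboveBound (S′ ∷ Ss) with candidate S′ in c
  ... | true  = ⊓-glb (vAll S′ c) (aboveBound Ss)
  ... | false = aboveBound Ss

mainTheorem6 : {n r : ℕ} (A : Presentation n r)
    → (∀ (x y : Fin n) → (φ A x ≺ φ A y) ≡ true → x Fin.< y)
    → (B : Sub n) → isBase A B ≡ true
    → ep A B ≡ sumEP A B + epRel A B
mainTheorem6 A sorted B baseB = begin
  ep A B                               ≡⟨ sym (m+[n∸m]≡n sumEP≤epB) ⟩
  sumEP A B + (ep A B ∸ sumEP A B)     ≡⟨ cong (λ m → sumEP A B + (ep A B ∸ m)) (sym epType≡sumEP) ⟩
  sumEP A B + (ep A B ∸ epType A B)    ∎
  where
  open ≡-Reasoning
  open Passivity A sorted B baseB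
  sumEP≤epB : sumEP A B ≤ ep A B
  sumEP≤epB = sumEP≤ep B trB (λ K → refl)
  epType≡sumEP : epType A B ≡ sumEP A B
  epType≡sumEP = epType-minimum A B (sumEP A B) sumEP≤epB sumEP≤candidate X X-candidate ep-X
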